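{- Let $G$ be a $2$-connected subcubic outerplanar graph, let $v$ be a vertex of $G$, and let $c\in\{\text{red},\text{blue}\}$. Then $G$ admits a crumby coloring in which $v$ receives color $c$.
   Context: A graph is subcubic if it has maximum degree at most $3$. A crumby coloring of a graph $H$ is a coloring of the vertices of $H$ with two colors, red and blue, such that the subgraph induced by the blue vertices has maximum degree at most $1$, and the subgraph induced by the red vertices has minimum degree at least $1$ and contains no path with $3$ edges. -}

module Defs where

open import Data.Nat using (ℕ; _≤_; _+_)
open import Data.Bool using (Bool; true; false; if_then_else_)
open import Data.Fin using (Fin) renaming (_<_ to _<ᶠ_)
open import Data.List using (List; map; allFin)
open import Data.Nat.ListAction using (sum)
open import Data.Unit using (⊤)
open import Data.Product using (_×_; ∃)
open import Data.Empty using (⊥)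
open import Relation.Nullary using (¬_)
open import Relation.Binary.PropositionalEquality using (_≡_; _≢_)
open import Function.Definitions using (Injective)

record Graph (n : ℕ) : Set where
  field
    adj    : Fin n → Fin n → Bool
    sym    : ∀ u v → adj u v ≡ adj v u
    irrefl : ∀ v → adj v v ≡ false
open Graph public

Adj : ∀ {n} → Graph n → Fin n → Fin n → Set
Adj G u v = adj G u v ≡ true

countB : ∀ {n} → (Fin n → Bool) → ℕ
countB {n} p = sum (map (λ u → if p u then 1 else 0) (allFin n))

degree : ∀ {n} → Graph n → Fin n → ℕ
degree G v = countB (adj G v)

Subcubic : ∀ {n} → Graph n → Set
Subcubic G = ∀ v → degree G v ≤ 3

data Reach {n} (G : Graph n) (S : Fin n → Set) : Fin n → Fin n → Set where
  here : ∀ {u} → S u → Reach G S u u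
  step : ∀ {u w v} → Reach G S u w → Adj G w v → S v → Reach G S u v

ConnectedOn : ∀ {n} → Graph n → (Fin n → Set) → Set
ConnectedOn G S = ∀ u v → S u → S v → Reach G S u v

Connected : ∀ {n} → Graph n → Set
Connected G = ConnectedOn G (λ _ → ⊤)

TwoConnected : ∀ {n} → Graph n → Set
TwoConnected {n} G =
  (3 ≤ n) × Connected G × (∀ x → ConnectedOn G (λ u → u ≢ x))

-- Outerplanar (combinatorial form): vertices can be placed in convex
-- position on a circle (positions given by an injective map into Fin n,
-- i.e. a cyclic order) such that no two edges, drawn as straight chords,
-- cross.
Outerplanar : ∀ {n} → Graph n → Set
Outerplanar {n} G = ∃ λ (pos : Fin n → Fin n) → Injective _≡_ _≡_ pos ×
  (∀ a b c d → Adj G a b → Adj G c d →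
     pos a <ᶠ pos c → pos c <ᶠ pos b → pos b <ᶠ pos d → ⊥)

data Colour : Set where
  red blue : Colour

isColour : Colour → Colour → Bool
isColour red  red  = true
isColour blue blue = true
isColour _    _    = false

colDegree : ∀ {n} → Graph n → (Fin n → Colour) → Colour → Fin n → ℕ
colDegree G f c v = countB (λ u → if adj G v u then isColour c (f u) else false)

Crumby : ∀ {n} → Graph n → (Fin n → Colour) → Set
Crumby G f =
  (∀ v → f v ≡ blue → colDegree G f blue v ≤ 1) ×
  (∀ v → f v ≡ red → ∃ λ u → Adj G v u × f u ≡ red) ×
  (∀ a b c d → a ≢ b → a ≢ c → a ≢ d → b ≢ c → b ≢ d → c ≢ d →
     f a ≡ red → f b ≡ red → f c ≡ red → f d ≡ red →
     Adj G a b → Adj G b c → Adj G c d → ⊥)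

-- A 2-connected outerplanar graph is a Hamiltonian cycle with non-crossing chords: in the cyclic
-- order of an outerplanar embedding consecutive vertices are adjacent, for otherwise a suitable
-- neighbour of one of them would be a cut vertex. Being subcubic, every vertex meets at most one
-- chord. Number the cycle 0, 1, …, m starting at v. An interval of this numbering that no chord
-- leaves is a sequence of items, each a vertex without chord or a chord over a smaller such
-- interval. A colouring of such an interval is summarised by a finite profile, the profiles of a
-- concatenation and of an interval under a chord are computed from those of the parts, and a finite
-- closure of families of realisable profiles, verified by evaluation, shows that either colour at
-- vertex 0 extends to a colouring of the whole cycle satisfying the crumby conditions locally.

module Submission where

open import Defs hiding (sym)
open import Data.Bool as Bool using (Bool; true; false; T; not; _∧_; _∨_; if_then_else_)
open import Data.Bool.Properties using (T?; T-∧; T-∨; ∧-identityʳ; ∨-comm; ¬-not)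
open import Data.Empty using (⊥; ⊥-elim)
open import Data.Fin as Fin using (Fin; zero; suc; toℕ; fromℕ<; punchOut)
open import Data.Fin.Properties using (all?; any?; toℕ-injective; toℕ<n; toℕ-fromℕ<; fromℕ<-injective; punchOut-injective; injective⇒≤)
open import Data.List using (List; []; _∷_; length)
open import Data.List.Membership.Propositional using (_∈_)
open import Data.List.Properties using (map-tabulate)
open import Data.List.Relation.Unary.All as All using (All; []; _∷_; lookupAny)
open import Data.List.Relation.Unary.AllPairs using (AllPairs; []; _∷_)
open import Data.List.Relation.Unary.Any as Any using (Any; here; there)
open import Data.Maybe using (Maybe; just; nothing)
open import Data.Nat as ℕ using (ℕ; zero; suc; pred; _+_; _≤_; _<_; z≤n; s≤s; z<s; _≤?_; _<?_; _≤ᵇ_)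
open import Data.Nat.ListAction using (sum)
open import Data.Nat.Properties hiding (_≟_)
open import Data.Product as Product using (_×_; _,_; ∃; proj₁; proj₂)
open import Data.Sum using (_⊎_; inj₁; inj₂; [_,_]′)
open import Data.Unit using (⊤; tt)
open import Data.Vec using (Vec; []; _∷_; lookup)
open import Function using (_∘_; id; case_of_)
open import Function.Bundles using (Equivalence)
open import Function.Definitions using (Injective)
open import Relation.Binary.Definitions using (DecidableEquality; tri<; tri≈; tri>)
open import Relation.Binary.PropositionalEquality
open import Relation.Nullary using (Dec; does; yes; no; ¬_; ¬?; _×-dec_; _→-dec_)
open import Relation.Nullary.Decidable using (dec-true; dec-false; from-yes)

-- Counting neighbours

private variable
  n : ℕ

countB-suc : (p : Fin (suc n) → Bool) → countB p ≡ (if p zero then 1 else 0) + countB (p ∘ suc)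
countB-suc p = cong ((if p zero then 1 else 0) +_) (cong sum (trans (map-tabulate suc f) (sym (map-tabulate id (f ∘ suc)))))
  where
  f : Fin (suc _) → ℕ
  f u = if p u then 1 else 0

countB-cong : {p q : Fin n → Bool} → (∀ u → p u ≡ q u) → countB p ≡ countB q
countB-cong {zero}  _   = refl
countB-cong {suc n} {p} {q} p≗q = begin
  countB p                                             ≡⟨ countB-suc p ⟩
  (if p zero then 1 else 0) + countB (p ∘ suc)
    ≡⟨ cong₂ (λ b m → (if b then 1 else 0) + m) (p≗q zero) (countB-cong (p≗q ∘ suc)) ⟩
  (if q zero then 1 else 0) + countB (q ∘ suc)         ≡⟨ countB-suc q ⟨
  countB q                                             ∎
  where open ≡-Reasoning

countB-false : (p : Fin n → Bool) → (∀ u → p u ≡ false) → countB p ≡ 0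
countB-false {zero}  _ _    = refl
countB-false {suc n} p none rewrite countB-suc p | none zero = countB-false (p ∘ suc) (none ∘ suc)

_∖_ : (Fin n → Bool) → Fin n → Fin n → Bool
(p ∖ x) u = p u ∧ not (does (u Fin.≟ x))

countB-∖ : (p : Fin n → Bool) (x : Fin n) → p x ≡ true → countB p ≡ suc (countB (p ∖ x))
countB-∖ p zero px
  rewrite countB-suc p | countB-suc (p ∖ zero) | px = cong suc (countB-cong (sym ∘ ∧-identityʳ ∘ p ∘ suc))
countB-∖ p (suc x) px
  rewrite countB-suc p | countB-suc (p ∖ suc x) | countB-∖ (p ∘ suc) x px | ∧-identityʳ (p zero) =
  +-suc _ _

countB-≤1 : (p : Fin n → Bool) → (∀ u w → p u ≡ true → p w ≡ true → u ≡ w) → countB p ≤ 1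
countB-≤1 p unique with any? (λ u → p u Bool.≟ true)
... | yes (x , px) = ≤-reflexive (trans (countB-∖ p x px) (cong suc (countB-false (p ∖ x) only-x)))
  where
  only-x : ∀ u → (p ∖ x) u ≡ false
  only-x u with p u in pu | u Fin.≟ x
  ... | false | _     = refl
  ... | true  | yes _ = refl
  ... | true  | no u≢x = ⊥-elim (u≢x (unique u x pu px))
... | no ∄x = subst (_≤ 1) (sym (countB-false p (λ u → ¬-not (λ pu → ∄x (u , pu))))) z≤n

distinct-≤-countB : (p : Fin n → Bool) (xs : List (Fin n)) → AllPairs _≢_ xs → All (λ x → p x ≡ true) xs →
  length xs ≤ countB p
distinct-≤-countB p []       _            _          = z≤n
distinct-≤-countB p (x ∷ xs) (x∉xs ∷ xs!) (px ∷ pxs) =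
  subst (suc (length xs) ≤_) (sym (countB-∖ p x px))
    (s≤s (distinct-≤-countB (p ∖ x) xs xs! (All.zipWith keep (x∉xs , pxs))))
  where
  keep : ∀ {y} → x ≢ y × p y ≡ true → (p ∖ x) y ≡ true
  keep {y} (x≢y , py) rewrite py | dec-false (y Fin.≟ x) (x≢y ∘ sym) = refl

-- The cyclic order of an outerplanar embedding

injective⇒surjective : ∀ {n} (f : Fin n → Fin n) → Injective _≡_ _≡_ f → ∀ y → ∃ λ x → f x ≡ y
injective⇒surjective {zero} f _ ()
injective⇒surjective {suc _} f f-inj y with any? (λ x → f x Fin.≟ y)
... | yes hit = hit
... | no miss = ⊥-elim (<-irrefl refl (injective⇒≤ g-inj))
  where
  g : Fin _ → Fin _
  g x = punchOut {i = y} (λ y≡fx → miss (x , sym y≡fx))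
  g-inj : Injective _≡_ _≡_ g
  g-inj {a} {b} = f-inj ∘ punchOut-injective (λ e → miss (a , sym e)) (λ e → miss (b , sym e))

adj-sym : ∀ {n} (G : Graph n) {u w} → Adj G u w → Adj G w u
adj-sym G {u} {w} uw = trans (Graph.sym G w u) uw

module _ {n : ℕ} (G : Graph n) where

  NonCrossing : (Fin n → ℕ) → Set
  NonCrossing f = ∀ a b c d → Adj G a b → Adj G c d → f a < f c → f c < f b → f b < f d → ⊥

  record Placement (f : Fin n → ℕ) : Set where
    field
      bounded     : ∀ u → f u < n
      injective   : ∀ {u w} → f u ≡ f w → u ≡ w
      nonCrossing : NonCrossing f

    surjective : ∀ {i} → i < n → ∃ λ u → f u ≡ i
    surjective {i} i<n =
      let u , e = injective⇒surjective (λ u → fromℕ< (bounded u))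
                    (λ {u} {w} → injective ∘ fromℕ<-injective (f u) (f w) _ _) (fromℕ< i<n)
      in u , fromℕ<-injective (f u) i _ _ e

  record CyclicNumbering (v : Fin n) : Set where
    field
      rank      : Fin n → ℕ
      placement : Placement rank
      rank-v    : rank v ≡ 0
    open Placement placement public

    vertexAt : ℕ → Fin n
    vertexAt i with i <? n
    ... | yes i<n = proj₁ (surjective i<n)
    ... | no  _   = v

    rank-vertexAt : ∀ {i} → i < n → rank (vertexAt i) ≡ i
    rank-vertexAt {i} i<n with i <? n
    ... | yes i<n′ = proj₂ (surjective i<n′)
    ... | no  i≮n  = ⊥-elim (i≮n i<n)

    vertexAt-rank : ∀ u → vertexAt (rank u) ≡ u
    vertexAt-rank u = injective (rank-vertexAt (bounded u))

module _ {m : ℕ} where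

  back : ℕ → ℕ
  back zero    = m
  back (suc i) = i

  back-≤ : ∀ {i} → i ≤ m → back i ≤ m
  back-≤ {zero}  _   = ≤-refl
  back-≤ {suc i} i≤m = ≤-trans (n≤1+n i) i≤m

  back-injective : ∀ {i j} → i ≤ m → j ≤ m → back i ≡ back j → i ≡ j
  back-injective {zero}  {zero}  _   _   _    = refl
  back-injective {suc i} {suc j} _   _   refl = refl
  back-injective {zero}  {suc j} _   j≤m refl = ⊥-elim (<-irrefl refl j≤m)
  back-injective {suc i} {zero}  i≤m _   refl = ⊥-elim (<-irrefl refl i≤m)

  back-below : ∀ {i j} → j ≤ m → back i < back j → i ≡ suc (back i)
  back-below {zero}  j≤m m<j = ⊥-elim (<⇒≱ m<j (back-≤ j≤m))
  back-below {suc i} _   _   = refl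

  back^ : ℕ → ℕ → ℕ
  back^ zero    i = i
  back^ (suc k) i = back^ k (back i)

  back^-+ : ∀ k j → back^ k (k + j) ≡ j
  back^-+ zero    j = refl
  back^-+ (suc k) j = back^-+ k j

module _ {m : ℕ} {G : Graph (suc m)} where

  rotate : ∀ {f} → Placement G f → Placement G (back ∘ f)
  rotate {f} P = record
    { bounded     = λ u → s≤s (back-≤ (≤m u))
    ; injective   = λ {u} {w} e → injective (back-injective (≤m u) (≤m w) e)
    ; nonCrossing = nc
    }
    where
    open Placement P
    ≤m : ∀ u → f u ≤ m
    ≤m u = ≤-pred (bounded u)
    unrotate : ∀ {x y} → f x ≡ suc (back (f x)) → f y ≡ suc (back (f y)) → back (f x) < back (f y) → f x < f y
    unrotate ex ey lt = subst₂ _<_ (sym ex) (sym ey) (s≤s lt)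
    nc : NonCrossing G (back ∘ f)
    nc a b c d ab cd ac cb bd = crossing (f d) refl bd
      where
      ea : f a ≡ suc (back (f a))
      ea = back-below (≤m c) ac
      ec : f c ≡ suc (back (f c))
      ec = back-below (≤m b) cb
      eb : f b ≡ suc (back (f b))
      eb = back-below (≤m d) bd
      crossing : ∀ k → f d ≡ k → back (f b) < back k → ⊥
      crossing zero    ed _   = nonCrossing d c a b (adj-sym G cd) ab
                                  (subst₂ _<_ (sym ed) (sym ea) z<s) (unrotate ea ec ac) (unrotate ec eb cb)
      crossing (suc k) ed b<k = nonCrossing a b c d ab cd (unrotate ea ec ac) (unrotate ec eb cb)
                                  (subst₂ _<_ (sym eb) (sym ed) (s≤s b<k))

  rotate^ : ∀ k {f} → Placement G f → Placement G (back^ {m} k ∘ f)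
  rotate^ zero    P = P
  rotate^ (suc k) P = rotate^ k (rotate P)

  outerplanar-numbering : Outerplanar G → (v : Fin (suc m)) → CyclicNumbering G v
  outerplanar-numbering (pos , pos-injective , pos-nonCrossing) v = record
    { rank      = back^ {m} (toℕ (pos v)) ∘ toℕ ∘ pos
    ; placement = rotate^ (toℕ (pos v)) embedding
    ; rank-v    = trans (cong (back^ {m} (toℕ (pos v))) (sym (+-identityʳ (toℕ (pos v))))) (back^-+ {m} (toℕ (pos v)) 0)
    }
    where
    embedding : Placement G (toℕ ∘ pos)
    embedding = record
      { bounded     = toℕ<n ∘ pos
      ; injective   = pos-injective ∘ toℕ-injective
      ; nonCrossing = pos-nonCrossing
      }

-- Consecutive vertices are adjacent

module _ {n} (G : Graph n) where

  adj-irrefl : ∀ {u} → ¬ Adj G u u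
  adj-irrefl {u} uu with () ← trans (sym uu) (Graph.irrefl G u)

  closed-avoiding⇒all : (∀ x → ConnectedOn G (λ u → u ≢ x)) → ∀ z (S : Fin n → Set) →
    (∀ {u w} → S u → Adj G u w → w ≢ z → S w) → ∀ {x y} → x ≢ z → y ≢ z → S x → S y
  closed-avoiding⇒all noCut z S closed x≢z y≢z Sx = along (noCut z _ _ x≢z y≢z)
    where
    along : ∀ {y′} → Reach G (λ u → u ≢ z) _ y′ → S y′
    along (here _)         = Sx
    along (step r uw w≢z) = closed (along r) uw w≢z

  has-neighbour : Connected G → ∀ {x y} → x ≢ y → ∃ λ w → Adj G y w
  has-neighbour conn {x} {y} x≢y = last-step (conn x y tt tt) x≢y
    where
    last-step : ∀ {x′ y′} → Reach G (λ _ → ⊤) x′ y′ → x′ ≢ y′ → ∃ λ w → Adj G y′ w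
    last-step (here _)                 x≢x = ⊥-elim (x≢x refl)
    last-step (step {w = w} _ wy _) _   = w , adj-sym G wy

  module _ {f : Fin n → ℕ} (P : Placement G f) where
    open Placement P

    record HighestNeighbourBelow (y : Fin n) (B : ℕ) : Set where
      field
        vertex   : Fin n
        adjacent : Adj G y vertex
        below    : f vertex < B
        highest  : ∀ {u} → Adj G y u → f u < B → f u ≤ f vertex

    highest-neighbour-below : ∀ y B → B ≤ n → HighestNeighbourBelow y B ⊎ (∀ {u} → Adj G y u → B ≤ f u)
    highest-neighbour-below y zero    _   = inj₂ (λ _ → z≤n)
    highest-neighbour-below y (suc B) B<n with surjective B<n
    ... | w , fw≡B with adj G y w in yw
    ...   | true  = inj₁ (record { vertex = w ; adjacent = yw ; below = subst (_< suc B) (sym fw≡B) ≤-refl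
                                  ; highest = λ _ fu<1+B → subst (_ ≤_) (sym fw≡B) (≤-pred fu<1+B) })
    ...   | false with highest-neighbour-below y B (<⇒≤ B<n)
    ...     | inj₁ H = inj₁ (record { vertex = vertex ; adjacent = adjacent ; below = m<n⇒m<1+n below
                                     ; highest = λ yu fu<1+B → highest yu (<-B yu fu<1+B) })
      where
      open HighestNeighbourBelow H
      <-B : ∀ {u} → Adj G y u → f u < suc B → f u < B
      <-B {u} yu fu<1+B = ≤∧≢⇒< (≤-pred fu<1+B) λ fu≡B → case injective (trans fu≡B (sym fw≡B)) of
        λ { refl → case trans (sym yu) yw of λ () }
    ...     | inj₂ none = inj₂ λ {u} yu → ≤∧≢⇒< (none yu) λ B≡fu → case injective (trans (sym B≡fu) (sym fw≡B)) of
        λ { refl → case trans (sym yu) yw of λ () }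

    -- If consecutive x and y were not adjacent, the highest neighbour z of y before y, or else the
    -- highest neighbour of y overall, would be a cut vertex: an edge leaving the arc from z to y
    -- would cross the edge yz.
    module _ (noCut : ∀ x → ConnectedOn G (λ u → u ≢ x))
             {x y : Fin n} (fy≡1+fx : suc (f x) ≡ f y) (¬yx : ¬ Adj G y x) where

      private
        x<y : f x < f y
        x<y = subst (f x <_) fy≡1+fx ≤-refl

      cut-below : HighestNeighbourBelow y (f y) → ⊥
      cut-below H = <-irrefl refl (proj₂ (closed-avoiding⇒all noCut z S closed x≢z y≢z (z<x , x<y)))
        where
        open HighestNeighbourBelow H renaming (vertex to z)
        z<x : f z < f x
        z<x = ≤∧≢⇒< (≤-pred (subst (f z <_) (sym fy≡1+fx) below))
                     λ fz≡fx → ¬yx (subst (Adj G y) (injective fz≡fx) adjacent)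
        x≢z : x ≢ z
        x≢z refl = <-irrefl refl z<x
        y≢z : y ≢ z
        y≢z refl = <-irrefl refl below
        S : Fin n → Set
        S u = f z < f u × f u < f y
        closed : ∀ {u w} → S u → Adj G u w → w ≢ z → S w
        closed {u} {w} (z<u , u<y) uw w≢z with <-cmp (f w) (f z)
        ... | tri< w<z _ _ = ⊥-elim (nonCrossing w u z y (adj-sym G uw) (adj-sym G adjacent) w<z z<u u<y)
        ... | tri≈ _ e _   = ⊥-elim (w≢z (injective e))
        ... | tri> _ _ z<w with <-cmp (f w) (f y)
        ...   | tri< w<y _ _ = z<w , w<y
        ...   | tri≈ _ e _   = ⊥-elim (<⇒≱ z<u (highest (subst (λ t → Adj G t u) (injective e) (adj-sym G uw)) u<y))
        ...   | tri> _ _ y<w = ⊥-elim (nonCrossing z y u w (adj-sym G adjacent) uw z<u u<y y<w)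

      cut-above : (∀ {u} → Adj G y u → f y ≤ f u) → HighestNeighbourBelow y n → ⊥
      cut-above none H = [ <-irrefl refl , <-asym y<z ]′ (closed-avoiding⇒all noCut z S closed x≢z y≢z (inj₁ x<y))
        where
        open HighestNeighbourBelow H renaming (vertex to z)
        y<z : f y < f z
        y<z = ≤∧≢⇒< (none adjacent) λ fy≡fz → adj-irrefl (subst (Adj G y) (sym (injective fy≡fz)) adjacent)
        x≢z : x ≢ z
        x≢z refl = <-asym x<y y<z
        y≢z : y ≢ z
        y≢z refl = <-irrefl refl y<z
        S : Fin n → Set
        S u = f u < f y ⊎ f z < f u
        closed : ∀ {u w} → S u → Adj G u w → w ≢ z → S w
        closed {u} {w} Su uw w≢z with <-cmp (f w) (f y)
        ... | tri< w<y _ _ = inj₁ w<y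
        ... | tri≈ _ e _   = ⊥-elim ([ (λ u<y → <⇒≱ u<y (none yu)) , (λ z<u → <⇒≱ z<u (highest yu (bounded u))) ]′ Su)
          where
          yu : Adj G y u
          yu = subst (λ t → Adj G t u) (injective e) (adj-sym G uw)
        ... | tri> _ _ y<w with <-cmp (f w) (f z) | Su
        ...   | tri> _ _ z<w | _        = inj₂ z<w
        ...   | tri≈ _ e _   | _        = ⊥-elim (w≢z (injective e))
        ...   | tri< w<z _ _ | inj₁ u<y = ⊥-elim (nonCrossing u w y z uw adjacent u<y y<w w<z)
        ...   | tri< w<z _ _ | inj₂ z<u = ⊥-elim (nonCrossing y z w u adjacent (adj-sym G uw) y<w w<z z<u)

    successor-adjacent : Connected G → (∀ x → ConnectedOn G (λ u → u ≢ x)) → ∀ {x y} → suc (f x) ≡ f y → Adj G x y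
    successor-adjacent conn noCut {x} {y} fy≡1+fx with adj G x y in xy
    ... | true  = refl
    ... | false = ⊥-elim (separated λ yx → case trans (sym xy) (adj-sym G yx) of λ ())
      where
      separated : ¬ Adj G y x → ⊥
      separated ¬yx with highest-neighbour-below y (f y) (<⇒≤ (bounded y)) | highest-neighbour-below y n ≤-refl
      ... | inj₁ H    | _         = cut-below noCut fy≡1+fx ¬yx H
      ... | inj₂ none | inj₁ H    = cut-above noCut fy≡1+fx ¬yx none H
      ... | inj₂ _    | inj₂ none =
        let w , yw = has-neighbour conn {x} (λ { refl → 1+n≢n fy≡1+fx }) in <⇒≱ (bounded w) (none yw)

module _ {m} {G : Graph (suc m)} {f : Fin (suc m) → ℕ} (P : Placement G f)
         (conn : Connected G) (noCut : ∀ x → ConnectedOn G (λ u → u ≢ x)) where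

  last-first-adjacent : 1 ≤ m → ∀ {x y} → f x ≡ m → f y ≡ 0 → Adj G x y
  last-first-adjacent (s≤s _) fx≡m fy≡0 =
    successor-adjacent G (rotate P) conn noCut (trans (cong (suc ∘ back) fx≡m) (cong back (sym fy≡0)))

-- Profiles of coloured intervals

same : Colour → Colour → ℕ
same red  red  = 1
same blue blue = 1
same _    _    = 0

same-sym : ∀ a b → same a b ≡ same b a
same-sym red  red  = refl
same-sym red  blue = refl
same-sym blue red  = refl
same-sym blue blue = refl

-- d counts the neighbours of the same colour. Asking every red edge for an end with no other red
-- neighbour excludes red paths with three edges, and (more than needed) red triangles.
vertexOK : Colour → ℕ → Bool
vertexOK blue d = d ≤ᵇ 1
vertexOK red  d = 1 ≤ᵇ d

edgeOK : Colour → ℕ → Colour → ℕ → Bool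
edgeOK red d red d′ = (d ≤ᵇ 1) ∨ (d′ ≤ᵇ 1)
edgeOK _   _ _   _  = true

-- A colouring of an interval [p, q] of the cycle that is closed under chords is summarised by its
-- profile: for a single vertex its colour; otherwise the colours of p and q, their numbers of
-- same-coloured neighbours inside [p, q], and for x, y ∈ {0, 1} whether every vertex strictly
-- inside and every edge inside satisfy the crumby conditions once p and q get x and y more
-- same-coloured neighbours from outside.
data Profile : Set where
  point   : Colour → Profile
  segment : (cₗ : Colour) (dₗ : ℕ) (cᵣ : Colour) (dᵣ : ℕ) (t₀₀ t₀₁ t₁₀ t₁₁ : Bool) → Profile

tolerates : Profile → ℕ → ℕ → Bool
tolerates (segment _ _ _ _ t _ _ _) 0 0 = t
tolerates (segment _ _ _ _ _ t _ _) 0 1 = t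
tolerates (segment _ _ _ _ _ _ t _) 1 0 = t
tolerates (segment _ _ _ _ _ _ _ t) 1 1 = t
tolerates _                         _ _ = false

segmentWith : Colour → ℕ → Colour → ℕ → (ℕ → ℕ → Bool) → Profile
segmentWith cₗ dₗ cᵣ dᵣ t = segment cₗ dₗ cᵣ dᵣ (t 0 0) (t 0 1) (t 1 0) (t 1 1)

tolerates-segmentWith : ∀ {cₗ dₗ cᵣ dᵣ} t x y → T (tolerates (segmentWith cₗ dₗ cᵣ dᵣ t) x y) → T (t x y)
tolerates-segmentWith _ 0             0             ok = ok
tolerates-segmentWith _ 0             1             ok = ok
tolerates-segmentWith _ 1             0             ok = ok
tolerates-segmentWith _ 1             1             ok = ok
tolerates-segmentWith _ 0             (suc (suc _)) ()
tolerates-segmentWith _ 1             (suc (suc _)) ()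
tolerates-segmentWith _ (suc (suc _)) _             ()

-- join s t is the profile of s on [p, q] followed by t on [q + 1, r], joined by the edge q(q + 1).
joinTolerance : Profile → Profile → ℕ → ℕ → Bool
joinTolerance (point cp) (point cr) x y = edgeOK cp (same cp cr + x) cr (same cp cr + y)
joinTolerance (point cp) t@(segment c₁ d₁ _ _ _ _ _ _) x y =
  tolerates t (same cp c₁) y ∧ vertexOK c₁ (d₁ + same cp c₁) ∧ edgeOK cp (same cp c₁ + x) c₁ (d₁ + same cp c₁)
joinTolerance s@(segment _ _ cq dq _ _ _ _) (point cr) x y =
  tolerates s x (same cq cr) ∧ vertexOK cq (dq + same cq cr) ∧ edgeOK cq (dq + same cq cr) cr (same cq cr + y)
joinTolerance s@(segment _ _ cq dq _ _ _ _) t@(segment c₁ d₁ _ _ _ _ _ _) x y =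
  tolerates s x (same cq c₁) ∧ tolerates t (same cq c₁) y ∧ vertexOK cq (dq + same cq c₁)
  ∧ vertexOK c₁ (d₁ + same cq c₁) ∧ edgeOK cq (dq + same cq c₁) c₁ (d₁ + same cq c₁)

join : Profile → Profile → Profile
join s@(point cp)                   t@(point cr)                   = segmentWith cp (same cp cr) cr (same cp cr) (joinTolerance s t)
join s@(point cp)                   t@(segment c₁ _ cr dr _ _ _ _) = segmentWith cp (same cp c₁) cr dr (joinTolerance s t)
join s@(segment cp dp cq _ _ _ _ _) t@(point cr)                   = segmentWith cp dp cr (same cq cr) (joinTolerance s t)
join s@(segment cp dp _ _ _ _ _ _)  t@(segment _ _ cr dr _ _ _ _)  = segmentWith cp dp cr dr (joinTolerance s t)

-- arch ck t cl is the profile of t on [p + 1, m] under the chord p(m + 1), with p and m + 1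
-- coloured ck and cl.
archTolerance : Colour → Profile → Colour → ℕ → ℕ → Bool
archTolerance ck (point cj) cl x y =
  vertexOK cj (same ck cj + same cj cl)
  ∧ edgeOK ck (same ck cj + same ck cl + x) cj (same ck cj + same cj cl)
  ∧ edgeOK cj (same ck cj + same cj cl) cl (same cj cl + same ck cl + y)
  ∧ edgeOK ck (same ck cj + same ck cl + x) cl (same cj cl + same ck cl + y)
archTolerance ck t@(segment cp dp cq dq _ _ _ _) cl x y =
  tolerates t (same ck cp) (same cq cl) ∧ vertexOK cp (dp + same ck cp) ∧ vertexOK cq (dq + same cq cl)
  ∧ edgeOK ck (same ck cp + same ck cl + x) cp (dp + same ck cp)
  ∧ edgeOK cq (dq + same cq cl) cl (same cq cl + same ck cl + y)
  ∧ edgeOK ck (same ck cp + same ck cl + x) cl (same cq cl + same ck cl + y)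

arch : Colour → Profile → Colour → Profile
arch ck t@(point cj)                 cl = segmentWith ck (same ck cj + same ck cl) cl (same cj cl + same ck cl) (archTolerance ck t cl)
arch ck t@(segment cp _ cq _ _ _ _ _) cl = segmentWith ck (same ck cp + same ck cl) cl (same cq cl + same ck cl) (archTolerance ck t cl)

-- closesCycle t c: t, taken on the whole cycle cut open between its last vertex and 0, still
-- satisfies the crumby conditions once the edge between them is put back, and 0 has colour c.
closesCycle : Profile → Colour → Bool
closesCycle t@(segment cp dp cq dq _ _ _ _) c = isColour c cp ∧ tolerates t (same cp cq) (same cp cq)
  ∧ vertexOK cp (dp + same cp cq) ∧ vertexOK cq (dq + same cp cq) ∧ edgeOK cp (dp + same cp cq) cq (dq + same cp cq)
closesCycle (point _) _ = false

isColour-sound : ∀ {a b} → T (isColour a b) → a ≡ b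
isColour-sound {red}  {red}  _ = refl
isColour-sound {blue} {blue} _ = refl

_≟ᶜ_ : DecidableEquality Colour
red  ≟ᶜ red  = yes refl
blue ≟ᶜ blue = yes refl
red  ≟ᶜ blue = no λ ()
blue ≟ᶜ red  = no λ ()

_≟ᴾ_ : DecidableEquality Profile
point c ≟ᴾ point c′ with c ≟ᶜ c′
... | yes refl = yes refl
... | no  c≢c′ = no λ { refl → c≢c′ refl }
point _ ≟ᴾ segment _ _ _ _ _ _ _ _ = no λ ()
segment _ _ _ _ _ _ _ _ ≟ᴾ point _ = no λ ()
segment a b c d e f g h ≟ᴾ segment a′ b′ c′ d′ e′ f′ g′ h′
  with a ≟ᶜ a′ | b ℕ.≟ b′ | c ≟ᶜ c′ | d ℕ.≟ d′ | e Bool.≟ e′ | f Bool.≟ f′ | g Bool.≟ g′ | h Bool.≟ h′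
... | yes refl | yes refl | yes refl | yes refl | yes refl | yes refl | yes refl | yes refl = yes refl
... | no ≢ | _    | _    | _    | _    | _    | _    | _    = no λ { refl → ≢ refl }
... | _    | no ≢ | _    | _    | _    | _    | _    | _    = no λ { refl → ≢ refl }
... | _    | _    | no ≢ | _    | _    | _    | _    | _    = no λ { refl → ≢ refl }
... | _    | _    | _    | no ≢ | _    | _    | _    | _    = no λ { refl → ≢ refl }
... | _    | _    | _    | _    | no ≢ | _    | _    | _    = no λ { refl → ≢ refl }
... | _    | _    | _    | _    | _    | no ≢ | _    | _    = no λ { refl → ≢ refl }
... | _    | _    | _    | _    | _    | _    | no ≢ | _    = no λ { refl → ≢ refl }
... | _    | _    | _    | _    | _    | _    | _    | no ≢ = no λ { refl → ≢ refl }

colours : List Colour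
colours = blue ∷ red ∷ []

∈-colours : ∀ c → c ∈ colours
∈-colours blue = here refl
∈-colours red  = there (here refl)

Family : Set
Family = List Profile

JoinsTo : Family → Family → Family → Set
JoinsTo A B C = All (λ t → Any (λ a → Any (λ b → join a b ≡ t) B) A) C

ArchesTo : Family → Family → Set
ArchesTo A C = All (λ t → Any (λ cₗ → Any (λ a → Any (λ cᵣ → arch cₗ a cᵣ ≡ t) colours) A) colours) C

ClosesCycle : Family → Set
ClosesCycle A = All (λ c → Any (λ t → T (closesCycle t c)) A) colours

joinsTo? : ∀ A B C → Dec (JoinsTo A B C)
joinsTo? A B C = All.all? (λ t → Any.any? (λ a → Any.any? (λ b → join a b ≟ᴾ t) B) A) C

archesTo? : ∀ A C → Dec (ArchesTo A C)
archesTo? A C = All.all? (λ t → Any.any? (λ cₗ → Any.any? (λ a → Any.any? (λ cᵣ → arch cₗ a cᵣ ≟ᴾ t) colours) A) colours) C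

closesCycle? : ∀ A → Dec (ClosesCycle A)
closesCycle? A = All.all? (λ c → Any.any? (λ t → T? (closesCycle t c)) A) colours

-- Every interval that no chord leaves gets a family of profiles, all realised on it: family 0 for
-- a vertex without chord, family item (suc (archTo k)) for a chord over an interval of family k,
-- and family joinTo i k for an item of family item i followed by an interval of family k. The
-- tables were found by computer search; the four facts below, checked by evaluation, say that the
-- promised profiles really arise by join and arch, and that every family a whole cycle can get
-- closes up with vertex 0 of either colour.
module Certificate where
  open import Agda.Builtin.FromNat using (Number; fromNat)
  import Data.Fin.Literals
  import Data.Nat.Literals

  instance
    ℕ-number : Number ℕ
    ℕ-number = Data.Nat.Literals.number
    Fin-number : ∀ {n} → Number (Fin n)
    Fin-number = Data.Fin.Literals.number _
    ⊤-instance : ⊤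
    ⊤-instance = tt

  families : Vec Family 47
  families =
    (point blue ∷ point red ∷ []) ∷
    (segment blue 0 red 1 true true true true ∷ segment blue 1 red 0 true true true true ∷ segment red 0 blue 1 true true true true ∷
     segment red 1 blue 0 true true true true ∷ segment red 1 red 1 true true true false ∷ []) ∷
    (segment blue 0 red 0 true true true true ∷ segment blue 1 blue 1 true true true true ∷ segment red 0 blue 0 true true true true ∷
     segment red 1 red 1 true true true false ∷ []) ∷
    (segment blue 0 red 1 true false true false ∷ segment blue 1 blue 1 true true true true ∷ segment blue 1 red 1 true true true true ∷
     segment red 1 blue 0 true true false false ∷ segment red 1 blue 1 true true true true ∷ segment red 1 red 1 true true true false ∷
     segment red 1 red 2 true true false false ∷ segment red 2 red 1 true false true false ∷ []) ∷
    (segment blue 0 red 0 true true true true ∷ segment blue 1 blue 1 true true true true ∷ segment blue 1 blue 2 true true true true ∷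
     segment blue 1 red 1 true false true false ∷ segment red 0 blue 0 true true true true ∷ segment red 1 blue 1 true true false false ∷
     segment red 1 red 2 true true false false ∷ segment red 2 red 1 true false true false ∷ []) ∷
    (segment blue 0 red 1 true true true true ∷ segment blue 1 red 0 true true true true ∷ segment red 0 blue 1 true true true true ∷
     segment red 0 red 0 true true true true ∷ segment red 1 blue 0 true true true true ∷ segment red 1 red 1 true false false false ∷ []) ∷
    (segment blue 0 blue 0 true true true true ∷ segment blue 0 red 1 true false true false ∷ segment red 0 red 0 true true true true ∷
     segment red 0 red 1 true true true true ∷ segment red 1 blue 1 true true true true ∷ segment red 1 red 0 true true true true ∷ []) ∷
    (segment blue 0 blue 0 true true true true ∷ segment blue 1 red 1 true true true true ∷ segment red 0 red 0 true true true true ∷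
     segment red 1 blue 0 true true true true ∷ segment red 1 blue 1 true true true true ∷ segment red 1 red 0 true true true true ∷
     segment red 1 red 1 true false false false ∷ []) ∷
    (segment blue 0 blue 0 true true true true ∷ segment blue 0 red 1 true true true true ∷ segment red 0 red 0 true true true true ∷
     segment red 0 red 1 true true true true ∷ segment red 1 blue 0 true true false false ∷ segment red 1 blue 1 true true true true ∷
     segment red 1 red 1 true false false false ∷ []) ∷
    (segment blue 0 blue 0 true true true true ∷ segment blue 0 blue 1 true true true true ∷ segment blue 0 red 0 true true true true ∷
     segment blue 0 red 1 true false true false ∷ segment red 0 blue 0 true true true true ∷ segment red 0 red 0 true true true true ∷
     segment red 0 red 1 true false true false ∷ segment red 1 blue 0 true true false false ∷ segment red 1 red 0 true true false false ∷ []) ∷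
    (segment blue 0 blue 0 true true true true ∷ segment blue 1 red 1 true false true false ∷ segment red 0 red 1 true true true true ∷
     segment red 1 blue 1 true true true true ∷ segment red 1 red 0 true true true true ∷ segment red 1 red 1 true true true true ∷ []) ∷
    (segment blue 0 blue 0 true true true true ∷ segment blue 0 red 1 true false true false ∷ segment red 0 blue 0 true true true true ∷
     segment red 0 red 1 true true true true ∷ segment red 1 blue 1 true true false false ∷ segment red 1 red 0 true true true true ∷ []) ∷
    (segment blue 0 blue 1 true true true true ∷ segment blue 0 red 1 true false true false ∷ segment blue 0 red 2 true true true true ∷
     segment blue 1 red 0 true true true true ∷ segment red 0 blue 1 true true true true ∷ segment red 0 blue 2 true true true true ∷
     segment red 0 red 0 true true true true ∷ segment red 0 red 1 true false true false ∷ segment red 1 blue 0 true true true true ∷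
     segment red 1 red 1 true false false false ∷ []) ∷
    (segment blue 0 red 1 true true true true ∷ segment blue 1 red 0 true true true true ∷ segment red 0 blue 1 true true true true ∷
     segment red 0 red 0 true true true true ∷ segment red 1 red 1 true false false false ∷ segment red 2 blue 0 true true true true ∷ []) ∷
    (segment blue 0 blue 0 true true true true ∷ segment blue 0 blue 1 true true true true ∷ segment blue 0 red 1 true true true true ∷
     segment blue 0 red 1 true false true false ∷ segment blue 0 red 2 true true true true ∷ segment red 0 blue 1 true true true true ∷
     segment red 0 red 1 true true true true ∷ segment red 0 red 1 true false true false ∷ segment red 1 blue 1 true true false false ∷
     segment red 1 red 1 true false false false ∷ []) ∷
    (segment blue 0 blue 0 true true true true ∷ segment blue 1 red 0 true true true true ∷ segment blue 1 red 1 true false true false ∷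
     segment red 1 blue 1 true true false false ∷ segment red 1 red 0 true true true true ∷ segment red 1 red 1 true false false false ∷
     segment red 2 blue 0 true true true true ∷ []) ∷
    (segment blue 0 blue 1 true true true true ∷ segment blue 0 red 0 true true true true ∷ segment blue 1 red 1 true false true false ∷
     segment red 0 blue 0 true true true true ∷ segment red 0 red 1 true false true false ∷ segment red 1 red 0 true true true true ∷
     segment red 1 red 1 true true true true ∷ []) ∷
    (segment blue 0 red 0 true true true true ∷ segment blue 0 red 1 true true true true ∷ segment blue 1 blue 0 true true true true ∷
     segment blue 1 blue 1 true true true true ∷ segment red 1 blue 0 true true true true ∷ segment red 1 blue 1 true true false false ∷
     segment red 1 red 0 true true true true ∷ segment red 1 red 1 true true true true ∷ []) ∷
    (segment blue 0 blue 1 true true true true ∷ segment blue 0 red 0 true true true true ∷ segment blue 0 red 1 true true true true ∷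
     segment red 0 blue 0 true true true true ∷ segment red 0 blue 1 true true true true ∷ segment red 0 red 0 true true true true ∷
     segment red 0 red 1 true true true true ∷ segment red 1 blue 0 true true false false ∷ segment red 1 red 1 true true false false ∷ []) ∷
    (segment blue 0 blue 0 true true true true ∷ segment blue 0 red 1 true false true false ∷ segment blue 1 red 0 true true true true ∷
     segment red 1 blue 0 true true true true ∷ segment red 1 blue 1 true true true true ∷ segment red 1 red 0 true true true true ∷
     segment red 1 red 1 true false true false ∷ []) ∷
    (segment blue 0 blue 0 true true true true ∷ segment blue 0 red 0 true true true true ∷ segment red 0 blue 0 true true true true ∷
     segment red 0 blue 1 true true true true ∷ segment red 0 red 0 true true true true ∷ segment red 0 red 1 true false true false ∷
     segment red 1 blue 0 true true true true ∷ segment red 1 red 0 true true true true ∷ segment red 1 red 1 true false true false ∷ []) ∷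
    (segment blue 0 blue 0 true true true true ∷ segment blue 0 red 1 true false true false ∷ segment red 0 red 0 true true true true ∷
     segment red 0 red 1 true true true true ∷ segment red 2 blue 1 true true true true ∷ segment red 2 red 0 true true true true ∷ []) ∷
    (segment blue 0 blue 0 true true true true ∷ segment blue 0 red 1 true false true false ∷ segment blue 1 red 2 true true true true ∷
     segment red 0 blue 1 true true true true ∷ segment red 0 red 1 true false true false ∷ segment red 0 red 2 true true true true ∷
     segment red 1 blue 1 true true true true ∷ segment red 1 blue 2 true true true true ∷ segment red 1 red 0 true true true true ∷ []) ∷
    (segment blue 0 blue 1 true true true true ∷ segment blue 0 red 0 true true true true ∷ segment blue 1 red 1 true false true false ∷
     segment red 0 blue 0 true true true true ∷ segment red 0 red 1 true false true false ∷ segment red 1 blue 0 true true true true ∷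
     segment red 1 red 1 true true true true ∷ []) ∷
    (segment blue 0 blue 1 true true true true ∷ segment blue 0 red 0 true true true true ∷ segment blue 0 red 1 true true true true ∷
     segment red 0 blue 0 true true true true ∷ segment red 0 red 1 true false true false ∷ segment red 1 blue 1 true true false false ∷
     segment red 1 red 1 true true true true ∷ []) ∷
    (segment blue 0 blue 1 true true true true ∷ segment blue 1 blue 0 true true true true ∷ segment blue 1 red 0 true true true true ∷
     segment blue 1 red 1 true true true true ∷ segment red 1 blue 0 true true true true ∷ segment red 1 blue 1 true true true true ∷
     segment red 1 red 0 true true true true ∷ segment red 1 red 1 true true true true ∷ []) ∷
    (segment blue 0 blue 0 true true true true ∷ segment blue 1 blue 1 true true true true ∷ segment blue 1 red 0 true true true true ∷
     segment blue 1 red 1 true true true true ∷ segment red 1 blue 0 true true true true ∷ segment red 1 blue 1 true true true true ∷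
     segment red 1 red 0 true true true true ∷ segment red 1 red 1 true true true true ∷ []) ∷
    (segment blue 0 blue 1 true true true true ∷ segment blue 0 red 0 true true true true ∷ segment blue 1 blue 0 true true true true ∷
     segment blue 1 red 1 true true true true ∷ segment red 1 blue 0 true true false false ∷ segment red 1 red 1 true true true true ∷
     segment red 2 blue 1 true true true true ∷ segment red 2 red 0 true true true true ∷ []) ∷
    (segment blue 0 red 1 true true true true ∷ segment blue 1 blue 1 true true true true ∷ segment blue 1 red 1 true false true false ∷
     segment red 1 blue 0 true true true true ∷ segment red 1 blue 1 true true true true ∷ segment red 1 red 1 true true true true ∷
     segment red 1 red 1 true false true false ∷ segment red 1 red 2 true true true true ∷ []) ∷
    (segment blue 0 blue 1 true true true true ∷ segment blue 0 red 1 true false true false ∷ segment blue 1 blue 0 true true true true ∷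
     segment blue 1 red 1 true true true true ∷ segment blue 1 red 2 true true true true ∷ segment red 0 blue 0 true true true true ∷
     segment red 0 blue 1 true true true true ∷ segment red 0 red 1 true true true true ∷ segment red 0 red 1 true false true false ∷
     segment red 0 red 2 true true true true ∷ segment red 1 blue 1 true true true true ∷ segment red 1 red 1 true true true true ∷ []) ∷
    (segment blue 0 blue 0 true true true true ∷ segment blue 0 red 0 true true true true ∷ segment blue 0 red 1 true false true false ∷
     segment red 0 blue 1 true true true true ∷ segment red 0 red 1 true false true false ∷ segment red 0 red 2 true true true true ∷
     segment red 1 blue 1 true true true true ∷ segment red 1 blue 2 true true true true ∷ segment red 1 red 0 true true true true ∷ []) ∷
    (segment blue 0 blue 0 true true true true ∷ segment blue 0 red 0 true true true true ∷ segment blue 0 red 1 true true true true ∷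
     segment red 0 blue 0 true true true true ∷ segment red 0 blue 1 true true true true ∷ segment red 0 red 0 true true true true ∷
     segment red 0 red 1 true true true true ∷ segment red 1 blue 1 true true false false ∷ segment red 1 red 1 true true false false ∷ []) ∷
    (segment blue 0 blue 0 true true true true ∷ segment blue 0 red 1 true false true false ∷ segment red 0 blue 0 true true true true ∷
     segment red 0 red 1 true true true true ∷ segment red 1 blue 1 true true false false ∷ segment red 2 red 0 true true true true ∷ []) ∷
    (segment blue 0 red 1 true true true true ∷ segment blue 1 red 0 true true true true ∷ segment red 0 blue 1 true true true true ∷
     segment red 1 blue 0 true true true true ∷ segment red 1 red 1 true true false false ∷ segment red 1 red 1 true false true false ∷ []) ∷
    (segment blue 0 red 1 true true true true ∷ segment blue 1 blue 0 true true true true ∷ segment blue 1 blue 1 true true true true ∷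
     segment blue 1 red 0 true true true true ∷ segment red 1 blue 1 true true true true ∷ segment red 1 red 0 true true false false ∷
     segment red 1 red 1 true false true false ∷ segment red 2 blue 0 true true true true ∷ segment red 2 red 1 true true true true ∷ []) ∷
    (segment blue 0 blue 1 true true true true ∷ segment blue 0 blue 2 true true true true ∷ segment blue 0 red 0 true true true true ∷
     segment blue 1 red 1 true false true false ∷ segment red 0 blue 0 true true true true ∷ segment red 1 blue 1 true true true true ∷
     segment red 1 red 1 true false true false ∷ segment red 1 red 2 true true true true ∷ []) ∷
    (segment blue 0 blue 1 true true true true ∷ segment blue 0 red 0 true true true true ∷ segment blue 1 red 1 true true true true ∷
     segment red 0 blue 0 true true true true ∷ segment red 0 red 1 true false true false ∷ segment red 2 red 0 true true true true ∷
     segment red 2 red 1 true true true true ∷ []) ∷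
    (segment blue 0 blue 0 true true true true ∷ segment blue 0 red 1 true false true false ∷ segment red 0 blue 0 true true true true ∷
     segment red 0 blue 1 true true true true ∷ segment red 0 red 1 true false true false ∷ segment red 0 red 2 true true true true ∷
     segment red 1 blue 1 true true false false ∷ segment red 1 blue 2 true true false false ∷ segment red 1 red 0 true true false false ∷
     segment red 1 red 1 true false false false ∷ segment red 1 red 2 true true false false ∷ []) ∷
    (segment blue 0 blue 0 true true true true ∷ segment blue 1 blue 1 true true true true ∷ segment blue 1 red 0 true true true true ∷
     segment blue 1 red 1 true false true false ∷ segment red 0 blue 0 true true true true ∷ segment red 0 red 0 true true true true ∷
     segment red 0 red 1 true false true false ∷ segment red 1 blue 0 true true false false ∷ segment red 1 red 0 true true false false ∷ []) ∷
    (segment blue 0 blue 0 true true true true ∷ segment blue 1 red 0 true true true true ∷ segment blue 1 red 1 true false true false ∷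
     segment red 2 blue 0 true true true true ∷ segment red 2 blue 1 true true true true ∷ segment red 2 red 0 true true true true ∷
     segment red 2 red 1 true false true false ∷ []) ∷
    (segment blue 1 blue 0 true true true true ∷ segment blue 1 red 0 true true true true ∷ segment blue 1 red 1 true false true false ∷
     segment red 1 blue 0 true true true true ∷ segment red 1 blue 1 true true true true ∷ segment red 1 red 0 true true true true ∷
     segment red 1 red 1 true false true false ∷ []) ∷
    (segment blue 0 red 0 true true true true ∷ segment blue 1 blue 1 true true true true ∷ segment blue 1 red 1 true true true true ∷
     segment red 0 blue 0 true true true true ∷ segment red 0 red 1 true false true false ∷ segment red 2 blue 0 true true true true ∷
     segment red 2 red 1 true true true true ∷ []) ∷
    (segment blue 0 blue 0 true true true true ∷ segment blue 0 red 1 true false true false ∷ segment blue 1 red 2 true true true true ∷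
     segment red 0 blue 1 true true true true ∷ segment red 0 red 1 true false true false ∷ segment red 0 red 2 true true true true ∷
     segment red 2 blue 1 true true true true ∷ segment red 2 blue 2 true true true true ∷ segment red 2 red 0 true true true true ∷ []) ∷
    (segment blue 0 red 1 true false true false ∷ segment blue 1 blue 0 true true true true ∷ segment blue 1 blue 1 true true true true ∷
     segment blue 1 red 2 true true true true ∷ segment red 1 blue 0 true true false false ∷ segment red 1 red 2 true true true true ∷
     segment red 2 blue 1 true true true true ∷ segment red 2 blue 2 true true true true ∷ segment red 2 red 0 true true true true ∷
     segment red 2 red 1 true false true false ∷ []) ∷
    (segment blue 0 red 1 true false true false ∷ segment blue 1 blue 1 true true true true ∷ segment blue 1 red 1 true true true true ∷
     segment red 1 blue 0 true true false false ∷ segment red 1 red 2 true true false false ∷ segment red 2 blue 1 true true true true ∷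
     segment red 2 red 1 true true true true ∷ segment red 2 red 1 true false true false ∷ []) ∷
    (segment blue 1 blue 0 true true true true ∷ segment blue 1 blue 1 true true true true ∷ segment blue 1 red 0 true true true true ∷
     segment blue 1 red 1 true false true false ∷ segment red 0 blue 0 true true true true ∷ segment red 0 red 0 true true true true ∷
     segment red 0 red 1 true false true false ∷ segment red 1 red 0 true true false false ∷ segment red 2 blue 0 true true true true ∷
     segment red 2 red 2 true true true true ∷ []) ∷
    (segment blue 0 red 2 true true true true ∷ segment blue 1 blue 1 true true true true ∷ segment blue 1 red 1 true false true false ∷
     segment red 0 blue 1 true true true true ∷ segment red 0 blue 2 true true true true ∷ segment red 0 red 0 true true true true ∷
     segment red 2 blue 0 true true true true ∷ segment red 2 red 0 true true true true ∷ segment red 2 red 1 true false true false ∷ []) ∷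
    []

  joinTable : Vec (Vec (Fin 47) 47) 5
  joinTable =
    (2 ∷ 8 ∷ 5 ∷ 14 ∷ 12 ∷ 6 ∷ 16 ∷ 11 ∷ 11 ∷ 20 ∷ 24 ∷ 23 ∷ 22 ∷ 6 ∷ 29 ∷ 9 ∷
     33 ∷ 18 ∷ 26 ∷ 9 ∷ 19 ∷ 16 ∷ 35 ∷ 33 ∷ 33 ∷ 18 ∷ 18 ∷ 31 ∷ 14 ∷ 28 ∷ 35 ∷ 25 ∷
     23 ∷ 8 ∷ 18 ∷ 12 ∷ 33 ∷ 35 ∷ 20 ∷ 9 ∷ 9 ∷ 33 ∷ 35 ∷ 37 ∷ 14 ∷ 20 ∷ 22 ∷ []) ∷
    (7 ∷ 17 ∷ 10 ∷ 28 ∷ 30 ∷ 17 ∷ 19 ∷ 20 ∷ 33 ∷ 19 ∷ 6 ∷ 19 ∷ 35 ∷ 17 ∷ 28 ∷ 19 ∷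
     6 ∷ 25 ∷ 17 ∷ 19 ∷ 9 ∷ 19 ∷ 19 ∷ 10 ∷ 10 ∷ 25 ∷ 25 ∷ 26 ∷ 28 ∷ 28 ∷ 19 ∷ 17 ∷
     19 ∷ 16 ∷ 10 ∷ 22 ∷ 6 ∷ 22 ∷ 19 ∷ 19 ∷ 19 ∷ 10 ∷ 19 ∷ 19 ∷ 28 ∷ 19 ∷ 35 ∷ []) ∷
    (5 ∷ 11 ∷ 6 ∷ 29 ∷ 22 ∷ 16 ∷ 33 ∷ 23 ∷ 23 ∷ 19 ∷ 33 ∷ 33 ∷ 35 ∷ 16 ∷ 28 ∷ 20 ∷
     6 ∷ 26 ∷ 18 ∷ 20 ∷ 9 ∷ 33 ∷ 12 ∷ 6 ∷ 6 ∷ 25 ∷ 25 ∷ 25 ∷ 29 ∷ 14 ∷ 12 ∷ 18 ∷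
     33 ∷ 11 ∷ 6 ∷ 22 ∷ 6 ∷ 12 ∷ 19 ∷ 20 ∷ 20 ∷ 6 ∷ 12 ∷ 35 ∷ 29 ∷ 19 ∷ 35 ∷ []) ∷
    (15 ∷ 17 ∷ 27 ∷ 28 ∷ 43 ∷ 17 ∷ 15 ∷ 15 ∷ 34 ∷ 15 ∷ 15 ∷ 15 ∷ 40 ∷ 17 ∷ 28 ∷ 15 ∷
     27 ∷ 17 ∷ 17 ∷ 15 ∷ 15 ∷ 15 ∷ 15 ∷ 25 ∷ 27 ∷ 17 ∷ 17 ∷ 17 ∷ 28 ∷ 28 ∷ 15 ∷ 17 ∷
     15 ∷ 17 ∷ 15 ∷ 43 ∷ 27 ∷ 15 ∷ 15 ∷ 15 ∷ 15 ∷ 17 ∷ 15 ∷ 15 ∷ 28 ∷ 15 ∷ 40 ∷ []) ∷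
    (13 ∷ 32 ∷ 21 ∷ 44 ∷ 42 ∷ 36 ∷ 13 ∷ 38 ∷ 41 ∷ 38 ∷ 13 ∷ 13 ∷ 37 ∷ 36 ∷ 44 ∷ 38 ∷
     21 ∷ 31 ∷ 18 ∷ 9 ∷ 9 ∷ 13 ∷ 4 ∷ 21 ∷ 21 ∷ 18 ∷ 18 ∷ 18 ∷ 14 ∷ 14 ∷ 4 ∷ 18 ∷
     13 ∷ 32 ∷ 13 ∷ 42 ∷ 21 ∷ 37 ∷ 39 ∷ 9 ∷ 9 ∷ 21 ∷ 4 ∷ 4 ∷ 44 ∷ 39 ∷ 9 ∷ []) ∷
    []

  archTable : Vec (Fin 4) 47
  archTable =
    0 ∷ 3 ∷ 2 ∷ 1 ∷ 1 ∷ 3 ∷ 0 ∷ 1 ∷ 1 ∷ 0 ∷ 0 ∷ 0 ∷ 1 ∷ 3 ∷ 1 ∷ 1 ∷ 2 ∷ 1 ∷ 1 ∷ 1 ∷ 0 ∷ 0 ∷ 0 ∷ 1 ∷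
    1 ∷ 1 ∷ 1 ∷ 1 ∷ 1 ∷ 1 ∷ 0 ∷ 1 ∷ 0 ∷ 3 ∷ 1 ∷ 1 ∷ 2 ∷ 0 ∷ 0 ∷ 1 ∷ 1 ∷ 1 ∷ 0 ∷ 1 ∷ 1 ∷ 1 ∷ 1 ∷ []

  family : Fin 47 → Family
  family = lookup families

  item : Fin 5 → Fin 47
  item = Fin._↑ˡ 42

  joinTo : Fin 5 → Fin 47 → Fin 47
  joinTo i = lookup (lookup joinTable i)

  archTo : Fin 47 → Fin 4
  archTo = lookup archTable

  joins : ∀ i k → JoinsTo (family (item i)) (family k) (family (joinTo i k))
  joins = from-yes (all? λ i → all? λ k → joinsTo? (family (item i)) (family k) (family (joinTo i k)))

  arches : ∀ k → ArchesTo (family k) (family (item (suc (archTo k))))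
  arches = from-yes (all? λ k → archesTo? (family k) (family (item (suc (archTo k)))))

  closes-point : ∀ k → k ≢ zero → ClosesCycle (family (joinTo zero k))
  closes-point = from-yes (all? λ k → ¬? (k Fin.≟ zero) →-dec closesCycle? (family (joinTo zero k)))

  closes-arch : ∀ a k → ClosesCycle (family (joinTo (suc a) k))
  closes-arch = from-yes (all? λ a → all? λ k → closesCycle? (family (joinTo (suc a) k)))

-- Colouring a cycle with non-crossing chords

module Cycle (last : ℕ) where

  prev : ℕ → ℕ
  prev zero    = last
  prev (suc i) = i

  next : ℕ → ℕ
  next i = if does (i ℕ.≟ last) then 0 else suc i

  prev-pred : ∀ {i} → 0 < i → prev i ≡ pred i
  prev-pred {suc i} _ = refl

  next-last : next last ≡ 0
  next-last rewrite dec-true (last ℕ.≟ last) refl = refl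

  next-< : ∀ {i} → i < last → next i ≡ suc i
  next-< {i} i<last rewrite dec-false (i ℕ.≟ last) (<⇒≢ i<last) = refl

  prev-≤ : ∀ {i} → i ≤ last → prev i ≤ last
  prev-≤ {zero}  _       = ≤-refl
  prev-≤ {suc i} i<last = <⇒≤ i<last

  next-≤ : ∀ {i} → i ≤ last → next i ≤ last
  next-≤ {i} i≤last with i ℕ.≟ last
  ... | yes refl   = subst (_≤ last) (sym next-last) z≤n
  ... | no  i≢last = subst (_≤ last) (sym (next-< (≤∧≢⇒< i≤last i≢last))) (≤∧≢⇒< i≤last i≢last)

  next-prev : ∀ {i} → i ≤ last → next (prev i) ≡ i
  next-prev {zero}  _      = next-last
  next-prev {suc i} i<last = next-< i<last

  prev-next : ∀ {i} → i ≤ last → prev (next i) ≡ i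
  prev-next {i} i≤last with i ℕ.≟ last
  ... | yes refl   = cong prev next-last
  ... | no  i≢last = cong prev (next-< (≤∧≢⇒< i≤last i≢last))

  far-apart : ∀ {i j} → i ≤ last → j ≤ last → j ≢ i → j ≢ prev i → j ≢ next i → suc i < j ⊎ suc j < i
  far-apart {i} {j} i≤last j≤last j≢i j≢prev j≢next with <-cmp i j
  ... | tri≈ _ i≡j _ = ⊥-elim (j≢i (sym i≡j))
  ... | tri< i<j _ _ = inj₁ (≤∧≢⇒< i<j λ i+1≡j → j≢next (trans (sym i+1≡j) (sym (next-< (<-≤-trans i<j j≤last)))))
  ... | tri> _ _ j<i = inj₂ (≤∧≢⇒< j<i λ j+1≡i → j≢prev (trans (cong pred j+1≡i) (sym (prev-pred (≤-trans (s≤s z≤n) j<i)))))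

  prev≢next : 2 ≤ last → ∀ {i} → i ≤ last → prev i ≢ next i
  prev≢next 2≤last {zero} _ last≡next0 = <-irrefl (sym (trans last≡next0 (next-< (<-trans z<s 2≤last)))) 2≤last
  prev≢next 2≤last {suc i} i<last with suc i ℕ.≟ last
  ... | yes refl   = λ i≡next → <-irrefl (sym (cong suc (trans i≡next next-last))) 2≤last
  ... | no  i≢last = λ i≡next → <-irrefl (trans i≡next (next-< (≤∧≢⇒< i<last i≢last))) (m<n⇒m<1+n (n<1+n i))

-- chord-long and chord-0 say that no chord joins two consecutive vertices of the cycle
-- 0, 1, …, last, 0.
record ChordedCycle : Set where
  field
    last        : ℕ
    2≤last      : 2 ≤ last
    chord       : ℕ → Maybe ℕ
    chord-sym   : ∀ {i j} → chord i ≡ just j → chord j ≡ just i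
    chord-≤     : ∀ {i j} → chord i ≡ just j → j ≤ last
    chord-long  : ∀ {i j} → chord i ≡ just j → suc i < j ⊎ suc j < i
    chord-0     : ∀ {j} → chord 0 ≡ just j → j < last
    noncrossing : ∀ {a b c d} → chord a ≡ just b → chord c ≡ just d → a < c → c < b → b < d → ⊥

module CycleColouring (C : ChordedCycle) where
  open ChordedCycle C
  open Cycle last

  Colouring : Set
  Colouring = ℕ → Colour

  sameIf : ∀ {P : Set} → Dec P → Colour → Colour → ℕ
  sameIf P? a b = if does P? then same a b else 0

  sameIf-yes : ∀ {P : Set} (P? : Dec P) {a b} → P → sameIf P? a b ≡ same a b
  sameIf-yes P? p rewrite dec-true P? p = refl

  sameIf-no : ∀ {P : Set} (P? : Dec P) {a b} → ¬ P → sameIf P? a b ≡ 0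
  sameIf-no P? ¬p rewrite dec-false P? ¬p = refl

  chordDegree : ℕ → ℕ → Colouring → ℕ → Maybe ℕ → ℕ
  chordDegree p q g w nothing  = 0
  chordDegree p q g w (just j) = sameIf (p ≤? j ×-dec j ≤? q) (g w) (g j)

  innerDegree : ℕ → ℕ → Colouring → ℕ → ℕ
  innerDegree p q g w = sameIf (p <? w) (g w) (g (pred w)) + sameIf (w <? q) (g w) (g (suc w))
                      + chordDegree p q g w (chord w)

  Linked : ℕ → ℕ → Set
  Linked w u = u ≡ suc w ⊎ w ≡ suc u ⊎ chord w ≡ just u

  ChordClosed : ℕ → ℕ → Set
  ChordClosed p q = ∀ {w j} → p ≤ w → w ≤ q → chord w ≡ just j → p ≤ j × j ≤ q

  InteriorDegrees : ℕ → ℕ → Colouring → (ℕ → ℕ) → Set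
  InteriorDegrees p q g D = ∀ {w} → p < w → w < q → D w ≡ innerDegree p q g w

  VerticesOK : ℕ → ℕ → Colouring → (ℕ → ℕ) → Set
  VerticesOK p q g D = ∀ {w} → p < w → w < q → T (vertexOK (g w) (D w))

  EdgesOK : ℕ → ℕ → Colouring → (ℕ → ℕ) → Set
  EdgesOK p q g D = ∀ {w u} → p ≤ w → w ≤ q → p ≤ u → u ≤ q → Linked w u → T (edgeOK (g w) (D w) (g u) (D u))

  -- D stands for the same-colour degrees in a larger coloured graph containing the interval: it
  -- agrees with innerDegree strictly inside, and exceeds it by x and y at the ends.
  Realises : ℕ → ℕ → Colouring → Profile → Set
  Realises p q g (point c) = p ≡ q × g p ≡ c
  Realises p q g t@(segment cp dp cq dq _ _ _ _) =
    p < q × g p ≡ cp × g q ≡ cq × innerDegree p q g p ≡ dp × innerDegree p q g q ≡ dq ×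
    (∀ x y D → T (tolerates t x y) → D p ≡ dp + x → D q ≡ dq + y → InteriorDegrees p q g D →
       VerticesOK p q g D × EdgesOK p q g D)

  chord-not-self : ∀ {w} → chord w ≡ just w → ⊥
  chord-not-self {w} e with chord-long e
  ... | inj₁ w+1<w = <-asym (n<1+n w) w+1<w
  ... | inj₂ w+1<w = <-asym (n<1+n w) w+1<w

  chord-functional : ∀ {w a b} → chord w ≡ just a → chord w ≡ just b → a ≡ b
  chord-functional wa wb with refl ← trans (sym wa) wb = refl

  point-no-chord : ∀ {p j} → ChordClosed p p → chord p ≡ just j → ⊥
  point-no-chord cl e with cl ≤-refl ≤-refl e
  ... | p≤j , j≤p rewrite ≤-antisym j≤p p≤j = chord-not-self e

  chordDegree-in : ∀ {p q g w j} → chord w ≡ just j → p ≤ j → j ≤ q → chordDegree p q g w (chord w) ≡ same (g w) (g j)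
  chordDegree-in {p} {q} {j = j} e p≤j j≤q rewrite e = sameIf-yes (p ≤? j ×-dec j ≤? q) (p≤j , j≤q)

  chordDegree-within : ∀ {p q p′ q′ g w} → ChordClosed p q → p ≤ w → w ≤ q → p′ ≤ p → q ≤ q′ →
    chordDegree p′ q′ g w (chord w) ≡ chordDegree p q g w (chord w)
  chordDegree-within {p} {q} {p′} {q′} {g} {w} cl p≤w w≤q p′≤p q≤q′ with chord w in e
  ... | nothing = refl
  ... | just j  = let p≤j , j≤q = cl p≤w w≤q e in
    trans (sameIf-yes (p′ ≤? j ×-dec j ≤? q′) (≤-trans p′≤p p≤j , ≤-trans j≤q q≤q′))
          (sym (sameIf-yes (p ≤? j ×-dec j ≤? q) (p≤j , j≤q)))

  private
    move-last : ∀ a b c → a + b + c ≡ a + 0 + c + b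
    move-last a b c rewrite +-identityʳ a | +-assoc a b c | +-assoc a c b | +-comm b c = refl

    move-first : ∀ a b c → a + b + c ≡ 0 + b + c + a
    move-first a b c rewrite +-assoc a b c = +-comm a (b + c)

  innerDegree-point : ∀ {p g} → ChordClosed p p → innerDegree p p g p ≡ 0
  innerDegree-point {p} cl rewrite dec-false (p <? p) (<-irrefl refl) with chord p in e
  ... | nothing = refl
  ... | just _  = ⊥-elim (point-no-chord cl e)

  module _ {p q r : ℕ} (g : Colouring) where

    innerDegree-left : ∀ {w} → ChordClosed p q → p ≤ w → w < q → q < r → innerDegree p r g w ≡ innerDegree p q g w
    innerDegree-left {w} cl p≤w w<q q<r
      rewrite sameIf-yes (w <? r) {g w} {g (suc w)} (<-trans w<q q<r) | sameIf-yes (w <? q) {g w} {g (suc w)} w<q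
            | chordDegree-within {g = g} cl p≤w (<⇒≤ w<q) ≤-refl (<⇒≤ q<r) = refl

    innerDegree-left-end : ChordClosed p q → p ≤ q → q < r →
      innerDegree p r g q ≡ innerDegree p q g q + same (g q) (g (suc q))
    innerDegree-left-end cl p≤q q<r
      rewrite sameIf-yes (q <? r) {g q} {g (suc q)} q<r | sameIf-no (q <? q) {g q} {g (suc q)} (<-irrefl refl)
            | chordDegree-within {g = g} cl p≤q ≤-refl ≤-refl (<⇒≤ q<r) =
        move-last (sameIf (p <? q) (g q) (g (pred q))) (same (g q) (g (suc q))) (chordDegree p q g q (chord q))

    innerDegree-right : ∀ {w} → ChordClosed (suc q) r → p ≤ q → suc q < w → w ≤ r →
      innerDegree p r g w ≡ innerDegree (suc q) r g w
    innerDegree-right {w} cl p≤q q+1<w w≤r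
      rewrite sameIf-yes (p <? w) {g w} {g (pred w)} (≤-trans (s≤s p≤q) (<⇒≤ q+1<w))
            | sameIf-yes (suc q <? w) {g w} {g (pred w)} q+1<w
            | chordDegree-within {g = g} cl (<⇒≤ q+1<w) w≤r (≤-trans p≤q (n≤1+n q)) ≤-refl = refl

    innerDegree-right-end : ChordClosed (suc q) r → p ≤ q → suc q ≤ r →
      innerDegree p r g (suc q) ≡ innerDegree (suc q) r g (suc q) + same (g (suc q)) (g q)
    innerDegree-right-end cl p≤q q<r
      rewrite sameIf-yes (p <? suc q) {g (suc q)} {g q} (s≤s p≤q) | sameIf-no (suc q <? suc q) {g (suc q)} {g q} (<-irrefl refl)
            | chordDegree-within {g = g} cl ≤-refl q<r (≤-trans p≤q (n≤1+n q)) ≤-refl =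
        move-first (same (g (suc q)) (g q)) (sameIf (suc q <? r) (g (suc q)) (g (suc (suc q))))
                   (chordDegree (suc q) r g (suc q) (chord (suc q)))

  module _ {p m : ℕ} (g : Colouring) (arc : chord p ≡ just (suc m)) (p<m : suc p ≤ m) where

    private
      p<m+1 : p < suc m
      p<m+1 = ≤-trans (n≤1+n (suc p)) (s≤s p<m)

    innerDegree-arch-left : innerDegree p (suc m) g p ≡ same (g p) (g (suc p)) + same (g p) (g (suc m))
    innerDegree-arch-left
      rewrite sameIf-no (p <? p) {g p} {g (pred p)} (<-irrefl refl) | sameIf-yes (p <? suc m) {g p} {g (suc p)} p<m+1
            | chordDegree-in {p} {suc m} {g} arc (<⇒≤ p<m+1) ≤-refl = refl

    innerDegree-arch-right : innerDegree p (suc m) g (suc m) ≡ same (g (suc m)) (g m) + same (g (suc m)) (g p)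
    innerDegree-arch-right
      rewrite sameIf-yes (p <? suc m) {g (suc m)} {g m} p<m+1 | sameIf-no (suc m <? suc m) {g (suc m)} {g (suc (suc m))} (<-irrefl refl)
            | chordDegree-in {p} {suc m} {g} (chord-sym arc) ≤-refl (<⇒≤ p<m+1) =
        cong (_+ same (g (suc m)) (g p)) (+-identityʳ (same (g (suc m)) (g m)))

    module _ (cl : ChordClosed (suc p) m) where

      innerDegree-under : ∀ {w} → suc p < w → w < m → innerDegree p (suc m) g w ≡ innerDegree (suc p) m g w
      innerDegree-under {w} p+1<w w<m
        rewrite sameIf-yes (p <? w) {g w} {g (pred w)} (<-trans (n<1+n p) p+1<w) | sameIf-yes (suc p <? w) {g w} {g (pred w)} p+1<w
              | sameIf-yes (w <? suc m) {g w} {g (suc w)} (<-trans w<m (n<1+n m)) | sameIf-yes (w <? m) {g w} {g (suc w)} w<m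
              | chordDegree-within {g = g} cl (<⇒≤ p+1<w) (<⇒≤ w<m) (n≤1+n p) (n≤1+n m) = refl

      innerDegree-under-left : suc p < m → innerDegree p (suc m) g (suc p) ≡ innerDegree (suc p) m g (suc p) + same (g (suc p)) (g p)
      innerDegree-under-left p+1<m
        rewrite sameIf-yes (p <? suc p) {g (suc p)} {g p} (n<1+n p) | sameIf-no (suc p <? suc p) {g (suc p)} {g p} (<-irrefl refl)
              | sameIf-yes (suc p <? suc m) {g (suc p)} {g (suc (suc p))} (<-trans p+1<m (n<1+n m))
              | sameIf-yes (suc p <? m) {g (suc p)} {g (suc (suc p))} p+1<m
              | chordDegree-within {g = g} cl ≤-refl (<⇒≤ p+1<m) (n≤1+n p) (n≤1+n m) =
        move-first (same (g (suc p)) (g p)) (same (g (suc p)) (g (suc (suc p)))) (chordDegree (suc p) m g (suc p) (chord (suc p)))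

      innerDegree-under-right : suc p < m → innerDegree p (suc m) g m ≡ innerDegree (suc p) m g m + same (g m) (g (suc m))
      innerDegree-under-right p+1<m
        rewrite sameIf-yes (p <? m) {g m} {g (pred m)} (<-trans (n<1+n p) p+1<m) | sameIf-yes (suc p <? m) {g m} {g (pred m)} p+1<m
              | sameIf-yes (m <? suc m) {g m} {g (suc m)} (n<1+n m) | sameIf-no (m <? m) {g m} {g (suc m)} (<-irrefl refl)
              | chordDegree-within {g = g} cl (<⇒≤ p+1<m) ≤-refl (n≤1+n p) (n≤1+n m) =
        move-last (same (g m) (g (pred m))) (same (g m) (g (suc m))) (chordDegree (suc p) m g m (chord m))

      innerDegree-under-point : suc p ≡ m → innerDegree p (suc m) g m ≡ same (g m) (g p) + same (g m) (g (suc m))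
      innerDegree-under-point refl
        rewrite sameIf-yes (p <? suc p) {g (suc p)} {g p} (n<1+n p) | sameIf-yes (suc p <? suc (suc p)) {g (suc p)} {g (suc (suc p))} (n<1+n (suc p))
        with chord (suc p) in e
      ... | nothing = +-identityʳ _
      ... | just _  = ⊥-elim (point-no-chord cl e)

  linked-irrefl : ∀ {w} → ¬ Linked w w
  linked-irrefl (inj₁ w≡w+1)        = <-irrefl w≡w+1 (n<1+n _)
  linked-irrefl (inj₂ (inj₁ w≡w+1)) = <-irrefl w≡w+1 (n<1+n _)
  linked-irrefl (inj₂ (inj₂ e))     = chord-not-self e

  edgeOK-sym : ∀ a d b d′ → edgeOK a d b d′ ≡ edgeOK b d′ a d
  edgeOK-sym red  d red  d′ = ∨-comm (d ≤ᵇ 1) (d′ ≤ᵇ 1)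
  edgeOK-sym red  _ blue _  = refl
  edgeOK-sym blue _ red  _  = refl
  edgeOK-sym blue _ blue _  = refl

  data ArchPosition (p m x : ℕ) : Set where
    left  : x ≡ p → ArchPosition p m x
    right : x ≡ suc m → ArchPosition p m x
    under : suc p ≤ x → x ≤ m → ArchPosition p m x

  arch-position : ∀ {p m x} → p ≤ x → x ≤ suc m → ArchPosition p m x
  arch-position {p} {m} {x} p≤x x≤m+1 with <-cmp p x | <-cmp x (suc m)
  ... | tri≈ _ p≡x _ | _             = left (sym p≡x)
  ... | _            | tri≈ _ x≡m+1 _ = right x≡m+1
  ... | tri< p<x _ _ | tri< x<m+1 _ _ = under p<x (≤-pred x<m+1)
  ... | tri< _ _ _   | tri> _ _ m+1<x = ⊥-elim (<⇒≱ m+1<x x≤m+1)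
  ... | tri> _ _ x<p | _              = ⊥-elim (<⇒≱ x<p p≤x)

  module _ (g : Colouring) (D : ℕ → ℕ) where

    no-interior : ∀ {p q} → q ≤ suc p → VerticesOK p q g D
    no-interior q≤p+1 p<w w<q = ⊥-elim (<-irrefl refl (≤-trans w<q (≤-trans q≤p+1 p<w)))

    point-edges : ∀ {p} → EdgesOK p p g D
    point-edges p≤w w≤p p≤u u≤p wu
      rewrite ≤-antisym w≤p p≤w | ≤-antisym u≤p p≤u = ⊥-elim (linked-irrefl wu)

    module _ {p q r : ℕ} where

      vertices-join : VerticesOK p q g D → VerticesOK (suc q) r g D →
        (p < q → T (vertexOK (g q) (D q))) → (suc q < r → T (vertexOK (g (suc q)) (D (suc q)))) → VerticesOK p r g D
      vertices-join insideₗ insideᵣ at-q at-q+1 {w} p<w w<r with <-cmp w q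
      ... | tri< w<q _ _ = insideₗ p<w w<q
      ... | tri≈ _ refl _ = at-q p<w
      ... | tri> _ _ q<w with <-cmp w (suc q)
      ...   | tri< w<q+1 _ _ = ⊥-elim (<-irrefl refl (<-≤-trans w<q+1 q<w))
      ...   | tri≈ _ refl _  = at-q+1 w<r
      ...   | tri> _ _ q+1<w = insideᵣ q+1<w w<r

      edges-join : ChordClosed p q → ChordClosed (suc q) r → EdgesOK p q g D → EdgesOK (suc q) r g D →
        T (edgeOK (g q) (D q) (g (suc q)) (D (suc q))) → EdgesOK p r g D
      edges-join clₗ clᵣ insideₗ insideᵣ bridge {w} {u} p≤w w≤r p≤u u≤r wu with w ≤? q | u ≤? q
      ... | yes w≤q | yes u≤q = insideₗ p≤w w≤q p≤u u≤q wu
      ... | no  w≰q | no  u≰q = insideᵣ (≰⇒> w≰q) w≤r (≰⇒> u≰q) u≤r wu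
      ... | yes w≤q | no  u≰q = crossing wu
        where
        crossing : Linked w u → T (edgeOK (g w) (D w) (g u) (D u))
        crossing (inj₁ refl) rewrite ≤-antisym w≤q (≤-pred (≰⇒> u≰q)) = bridge
        crossing (inj₂ (inj₁ refl)) = ⊥-elim (u≰q (≤-trans (n≤1+n u) w≤q))
        crossing (inj₂ (inj₂ e))    = ⊥-elim (u≰q (proj₂ (clₗ p≤w w≤q e)))
      ... | no  w≰q | yes u≤q = crossing wu
        where
        crossing : Linked w u → T (edgeOK (g w) (D w) (g u) (D u))
        crossing (inj₁ refl) = ⊥-elim (w≰q (≤-trans (n≤1+n w) u≤q))
        crossing (inj₂ (inj₁ refl)) rewrite ≤-antisym u≤q (≤-pred (≰⇒> w≰q)) =
          subst T (edgeOK-sym (g q) (D q) (g (suc q)) (D (suc q))) bridge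
        crossing (inj₂ (inj₂ e))    = ⊥-elim (<⇒≱ (s≤s u≤q) (proj₁ (clᵣ (≰⇒> w≰q) w≤r e)))

      interior-left : ChordClosed p q → q < r → InteriorDegrees p r g D → InteriorDegrees p q g D
      interior-left cl q<r degrees p<w w<q = trans (degrees p<w (<-trans w<q q<r)) (innerDegree-left g cl (<⇒≤ p<w) w<q q<r)

      interior-right : ChordClosed (suc q) r → p ≤ q → InteriorDegrees p r g D → InteriorDegrees (suc q) r g D
      interior-right cl p≤q degrees q+1<w w<r =
        trans (degrees (≤-trans (s≤s p≤q) (<⇒≤ q+1<w)) w<r) (innerDegree-right g cl p≤q q+1<w (<⇒≤ w<r))

    module _ {p m : ℕ} (arc : chord p ≡ just (suc m)) where

      vertices-arch : VerticesOK (suc p) m g D → T (vertexOK (g (suc p)) (D (suc p))) → T (vertexOK (g m) (D m)) →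
        VerticesOK p (suc m) g D
      vertices-arch inner at-p+1 at-m {w} p<w w<m+1 with <-cmp w (suc p) | <-cmp w m
      ... | tri< w<p+1 _ _ | _              = ⊥-elim (<-irrefl refl (<-≤-trans w<p+1 p<w))
      ... | tri≈ _ refl _  | _              = at-p+1
      ... | _              | tri≈ _ refl _  = at-m
      ... | tri> _ _ p+1<w | tri< w<m _ _   = inner p+1<w w<m
      ... | tri> _ _ _     | tri> _ _ m<w   = ⊥-elim (<-irrefl refl (<-≤-trans m<w (≤-pred w<m+1)))

      edges-arch : EdgesOK (suc p) m g D → T (edgeOK (g p) (D p) (g (suc p)) (D (suc p))) →
        T (edgeOK (g m) (D m) (g (suc m)) (D (suc m))) → T (edgeOK (g p) (D p) (g (suc m)) (D (suc m))) →
        EdgesOK p (suc m) g D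
      edges-arch inner first last span {w} {u} p≤w w≤m+1 p≤u u≤m+1 wu
        with arch-position {p} {m} p≤w w≤m+1 | arch-position {p} {m} p≤u u≤m+1
      ... | left refl  | left refl  = ⊥-elim (linked-irrefl wu)
      ... | right refl | right refl = ⊥-elim (linked-irrefl wu)
      ... | left refl  | right refl = span
      ... | right refl | left refl  = subst T (edgeOK-sym (g p) (D p) (g (suc m)) (D (suc m))) span
      ... | under p<w w≤m | under p<u u≤m = inner p<w w≤m p<u u≤m wu
      ... | left refl | under p<u u≤m with wu
      ...   | inj₁ refl        = first
      ...   | inj₂ (inj₁ refl) = ⊥-elim (<⇒≱ p<u (n≤1+n u))
      ...   | inj₂ (inj₂ e)    with refl ← chord-functional arc e = ⊥-elim (<-irrefl refl u≤m)
      edges-arch inner first last span {w} {u} p≤w w≤m+1 p≤u u≤m+1 wu | under p<w w≤m | left refl with wu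
      ...   | inj₁ refl        = ⊥-elim (<⇒≱ p<w (n≤1+n w))
      ...   | inj₂ (inj₁ refl) = subst T (edgeOK-sym (g p) (D p) (g (suc p)) (D (suc p))) first
      ...   | inj₂ (inj₂ e)    with refl ← chord-functional arc (chord-sym e) = ⊥-elim (<-irrefl refl w≤m)
      edges-arch inner first last span {w} {u} p≤w w≤m+1 p≤u u≤m+1 wu | right refl | under p<u u≤m with wu
      ...   | inj₁ refl        = ⊥-elim (<⇒≱ u≤m (n≤1+n m))
      ...   | inj₂ (inj₁ refl) = subst T (edgeOK-sym (g m) (D m) (g (suc m)) (D (suc m))) last
      ...   | inj₂ (inj₂ e)    with refl ← chord-functional (chord-sym arc) e = ⊥-elim (<-irrefl refl p<u)
      edges-arch inner first last span {w} {u} p≤w w≤m+1 p≤u u≤m+1 wu | under p<w w≤m | right refl with wu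
      ...   | inj₁ refl        = last
      ...   | inj₂ (inj₁ refl) = ⊥-elim (<⇒≱ w≤m (n≤1+n m))
      ...   | inj₂ (inj₂ e)    with refl ← chord-functional (chord-sym arc) (chord-sym e) = ⊥-elim (<-irrefl refl p<w)

  private
    split : ∀ {a b} → T (a ∧ b) → T a × T b
    split = Equivalence.to T-∧

  vertex-at : ∀ {c c′ d d′} → c ≡ c′ → d ≡ d′ → T (vertexOK c′ d′) → T (vertexOK c d)
  vertex-at refl refl ok = ok

  edge-at : ∀ {a a′ d d′ b b′ e e′} → a ≡ a′ → d ≡ d′ → b ≡ b′ → e ≡ e′ → T (edgeOK a′ d′ b′ e′) → T (edgeOK a d b e)
  edge-at refl refl refl refl ok = ok

  module _ {g : Colouring} {D : ℕ → ℕ} {p q r : ℕ} where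

    degree-before-gap : ChordClosed p q → p < q → q < r → InteriorDegrees p r g D →
      ∀ {d a b} → innerDegree p q g q ≡ d → g q ≡ a → g (suc q) ≡ b → D q ≡ d + same a b
    degree-before-gap cl p<q q<r degrees deg ga gb = begin
      D q                                          ≡⟨ degrees p<q q<r ⟩
      innerDegree p r g q                          ≡⟨ innerDegree-left-end g cl (<⇒≤ p<q) q<r ⟩
      innerDegree p q g q + same (g q) (g (suc q)) ≡⟨ cong₂ _+_ deg (cong₂ same ga gb) ⟩
      _                                            ∎
      where open ≡-Reasoning

    degree-after-gap : ChordClosed (suc q) r → p ≤ q → suc q < r → InteriorDegrees p r g D →
      ∀ {d a b} → innerDegree (suc q) r g (suc q) ≡ d → g q ≡ a → g (suc q) ≡ b → D (suc q) ≡ d + same a b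
    degree-after-gap cl p≤q q+1<r degrees {d} {a} {b} deg ga gb = begin
      D (suc q)                                                ≡⟨ degrees (s≤s p≤q) q+1<r ⟩
      innerDegree p r g (suc q)                                ≡⟨ innerDegree-right-end g cl p≤q (<⇒≤ q+1<r) ⟩
      innerDegree (suc q) r g (suc q) + same (g (suc q)) (g q) ≡⟨ cong₂ _+_ deg (cong₂ same gb ga) ⟩
      d + same b a                                             ≡⟨ cong (d +_) (same-sym b a) ⟩
      d + same a b                                             ∎
      where open ≡-Reasoning

  join-sound : ∀ {g p q r} s t → ChordClosed p q → ChordClosed (suc q) r →
    Realises p q g s → Realises (suc q) r g t → Realises p r g (join s t)
  join-sound {g} {p} (point cp) (point cr) clₗ clᵣ (refl , gp) (refl , gr) =
    n<1+n p , gp , gr , degₗ , degᵣ , λ x y D tol Dp Dr _ →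
      no-interior g D ≤-refl ,
      edges-join g D clₗ clᵣ (point-edges g D) (point-edges g D)
        (edge-at gp Dp gr Dr (tolerates-segmentWith (joinTolerance (point cp) (point cr)) x y tol))
    where
    degₗ : innerDegree p (suc p) g p ≡ same cp cr
    degₗ rewrite innerDegree-left-end g clₗ ≤-refl (n<1+n p) | innerDegree-point {p} {g} clₗ | gp | gr = refl
    degᵣ : innerDegree p (suc p) g (suc p) ≡ same cp cr
    degᵣ rewrite innerDegree-right-end {p} g clᵣ ≤-refl ≤-refl | innerDegree-point {suc p} {g} clᵣ | gp | gr = same-sym cr cp
  join-sound {g} {p} {_} {r} (point cp) t@(segment c₁ d₁ cr dr _ _ _ _) clₗ clᵣ
             (refl , gp) (p+1<r , g₁ , gr , deg₁ , degr , inner) =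
    <-trans (n<1+n p) p+1<r , gp , gr , degₗ , trans (innerDegree-right g clᵣ ≤-refl p+1<r ≤-refl) degr , body
    where
    δ = same cp c₁
    degₗ : innerDegree p r g p ≡ δ
    degₗ rewrite innerDegree-left-end g clₗ ≤-refl (<-trans (n<1+n p) p+1<r) | innerDegree-point {p} {g} clₗ | gp | g₁ = refl
    body : ∀ x y D → T (tolerates (join (point cp) t) x y) → D p ≡ δ + x → D r ≡ dr + y →
      InteriorDegrees p r g D → VerticesOK p r g D × EdgesOK p r g D
    body x y D tol Dp Dr degrees =
      let tolᵣ , ok₁ , bridge = conditions
          verticesᵣ , edgesᵣ = inner δ y D tolᵣ D₁ Dr (interior-right g D clᵣ ≤-refl degrees)
      in vertices-join g D (no-interior g D (n≤1+n p)) verticesᵣ (⊥-elim ∘ <-irrefl refl) (λ _ → vertex-at g₁ D₁ ok₁)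
       , edges-join g D clₗ clᵣ (point-edges g D) edgesᵣ (edge-at gp Dp g₁ D₁ bridge)
      where
      conditions : T (tolerates t δ y) × T (vertexOK c₁ (d₁ + δ)) × T (edgeOK cp (δ + x) c₁ (d₁ + δ))
      conditions = Product.map₂ split (split (tolerates-segmentWith (joinTolerance (point cp) t) x y tol))
      D₁ : D (suc p) ≡ d₁ + δ
      D₁ = degree-after-gap clᵣ ≤-refl p+1<r degrees deg₁ gp g₁
  join-sound {g} {p} {q} s@(segment cp dp cq dq _ _ _ _) (point cr) clₗ clᵣ (p<q , gp , gq , degp , degq , inner) (refl , gr) =
    <-trans p<q (n<1+n q) , gp , gr , trans (innerDegree-left g clₗ ≤-refl p<q (n<1+n q)) degp , degᵣ , body
    where
    degᵣ : innerDegree p (suc q) g (suc q) ≡ same cq cr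
    degᵣ rewrite innerDegree-right-end {p} g clᵣ (<⇒≤ p<q) ≤-refl | innerDegree-point {suc q} {g} clᵣ | gq | gr = same-sym cr cq
    body : ∀ x y D → T (tolerates (join s (point cr)) x y) → D p ≡ dp + x → D (suc q) ≡ same cq cr + y →
      InteriorDegrees p (suc q) g D → VerticesOK p (suc q) g D × EdgesOK p (suc q) g D
    body x y D tol Dp Dr degrees =
      let tolₗ , okq , bridge = conditions
          verticesₗ , edgesₗ = inner x (same cq cr) D tolₗ Dp Dq (interior-left g D clₗ (n<1+n q) degrees)
      in vertices-join g D verticesₗ (no-interior g D (n≤1+n (suc q))) (λ _ → vertex-at gq Dq okq) (⊥-elim ∘ <-irrefl refl)
       , edges-join g D clₗ clᵣ edgesₗ (point-edges g D) (edge-at gq Dq gr Dr bridge)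
      where
      conditions : T (tolerates s x (same cq cr)) × T (vertexOK cq (dq + same cq cr)) × T (edgeOK cq (dq + same cq cr) cr (same cq cr + y))
      conditions = Product.map₂ split (split (tolerates-segmentWith (joinTolerance s (point cr)) x y tol))
      Dq : D q ≡ dq + same cq cr
      Dq = degree-before-gap clₗ p<q (n<1+n q) degrees degq gq gr
  join-sound {g} {p} {q} {r} s@(segment cp dp cq dq _ _ _ _) t@(segment c₁ d₁ cr dr _ _ _ _) clₗ clᵣ
             (p<q , gp , gq , degp , degq , innerₗ) (q+1<r , g₁ , gr , deg₁ , degr , innerᵣ) =
    <-trans p<q (<-trans (n<1+n q) q+1<r) , gp , gr ,
    trans (innerDegree-left g clₗ ≤-refl p<q (<-trans (n<1+n q) q+1<r)) degp ,
    trans (innerDegree-right g clᵣ (<⇒≤ p<q) q+1<r ≤-refl) degr , body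
    where
    body : ∀ x y D → T (tolerates (join s t) x y) → D p ≡ dp + x → D r ≡ dr + y →
      InteriorDegrees p r g D → VerticesOK p r g D × EdgesOK p r g D
    body x y D tol Dp Dr degrees =
      let tolₗ , tolᵣ , okq , okq+1 , bridge = conditions
          verticesₗ , edgesₗ = innerₗ x (same cq c₁) D tolₗ Dp Dq (interior-left g D clₗ (<-trans (n<1+n q) q+1<r) degrees)
          verticesᵣ , edgesᵣ = innerᵣ (same cq c₁) y D tolᵣ Dq+1 Dr (interior-right g D clᵣ (<⇒≤ p<q) degrees)
      in vertices-join g D verticesₗ verticesᵣ (λ _ → vertex-at gq Dq okq) (λ _ → vertex-at g₁ Dq+1 okq+1)
       , edges-join g D clₗ clᵣ edgesₗ edgesᵣ (edge-at gq Dq g₁ Dq+1 bridge)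
      where
      conditions : T (tolerates s x (same cq c₁)) × T (tolerates t (same cq c₁) y) × T (vertexOK cq (dq + same cq c₁))
                 × T (vertexOK c₁ (d₁ + same cq c₁)) × T (edgeOK cq (dq + same cq c₁) c₁ (d₁ + same cq c₁))
      conditions = Product.map₂ (Product.map₂ (Product.map₂ split ∘ split) ∘ split)
                     (split (tolerates-segmentWith (joinTolerance s t) x y tol))
      Dq : D q ≡ dq + same cq c₁
      Dq = degree-before-gap clₗ p<q (<-trans (n<1+n q) q+1<r) degrees degq gq g₁
      Dq+1 : D (suc q) ≡ d₁ + same cq c₁
      Dq+1 = degree-after-gap clᵣ (<⇒≤ p<q) q+1<r degrees deg₁ gq g₁

  interior-under : ∀ {g D p m} → chord p ≡ just (suc m) → suc p ≤ m → ChordClosed (suc p) m →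
    InteriorDegrees p (suc m) g D → InteriorDegrees (suc p) m g D
  interior-under {g} {p = p} {m} arc p<m cl degrees p+1<w w<m =
    trans (degrees (<-trans (n<1+n p) p+1<w) (<-trans w<m (n<1+n m))) (innerDegree-under g arc p<m cl p+1<w w<m)

  module _ {g : Colouring} {D : ℕ → ℕ} {p m : ℕ} (arc : chord p ≡ just (suc m)) (cl : ChordClosed (suc p) m)
           (degrees : InteriorDegrees p (suc m) g D) where

    degree-under-first : suc p < m → ∀ {d a b} → innerDegree (suc p) m g (suc p) ≡ d → g p ≡ a → g (suc p) ≡ b →
      D (suc p) ≡ d + same a b
    degree-under-first p+1<m {d} {a} {b} deg ga gb = begin
      D (suc p)                                                ≡⟨ degrees (n<1+n p) (<-trans p+1<m (n<1+n m)) ⟩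
      innerDegree p (suc m) g (suc p)                          ≡⟨ innerDegree-under-left g arc (<⇒≤ p+1<m) cl p+1<m ⟩
      innerDegree (suc p) m g (suc p) + same (g (suc p)) (g p) ≡⟨ cong₂ _+_ deg (cong₂ same gb ga) ⟩
      d + same b a                                             ≡⟨ cong (d +_) (same-sym b a) ⟩
      d + same a b                                             ∎
      where open ≡-Reasoning

    degree-under-last : suc p < m → ∀ {d a b} → innerDegree (suc p) m g m ≡ d → g m ≡ a → g (suc m) ≡ b →
      D m ≡ d + same a b
    degree-under-last p+1<m deg ga gb = begin
      D m                                                ≡⟨ degrees (<-trans (n<1+n p) p+1<m) (n<1+n m) ⟩
      innerDegree p (suc m) g m                          ≡⟨ innerDegree-under-right g arc (<⇒≤ p+1<m) cl p+1<m ⟩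
      innerDegree (suc p) m g m + same (g m) (g (suc m)) ≡⟨ cong₂ _+_ deg (cong₂ same ga gb) ⟩
      _                                                  ∎
      where open ≡-Reasoning

  arch-sound : ∀ {g p m} ck t cl → chord p ≡ just (suc m) → ChordClosed (suc p) m → g p ≡ ck → g (suc m) ≡ cl →
    Realises (suc p) m g t → Realises p (suc m) g (arch ck t cl)
  arch-sound {g} {p} ck (point cj) cl arc clᵢ gp gl (refl , gj) =
    <-trans (n<1+n p) (n<1+n (suc p)) , gp , gl , degₗ , degᵣ , body
    where
    degₗ : innerDegree p (suc (suc p)) g p ≡ same ck cj + same ck cl
    degₗ rewrite innerDegree-arch-left g arc ≤-refl | gp | gj | gl = refl
    degᵣ : innerDegree p (suc (suc p)) g (suc (suc p)) ≡ same cj cl + same ck cl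
    degᵣ rewrite innerDegree-arch-right g arc ≤-refl | gp | gj | gl = cong₂ _+_ (same-sym cl cj) (same-sym cl ck)
    body : ∀ x y D → T (tolerates (arch ck (point cj) cl) x y) → D p ≡ same ck cj + same ck cl + x →
      D (suc (suc p)) ≡ same cj cl + same ck cl + y → InteriorDegrees p (suc (suc p)) g D →
      VerticesOK p (suc (suc p)) g D × EdgesOK p (suc (suc p)) g D
    body x y D tol Dp Dl degrees =
      let okj , first , last , span = conditions
      in vertices-arch g D arc (no-interior g D (n≤1+n (suc p))) (vertex-at gj Dj okj) (vertex-at gj Dj okj)
       , edges-arch g D arc (point-edges g D) (edge-at gp Dp gj Dj first) (edge-at gj Dj gl Dl last) (edge-at gp Dp gl Dl span)
      where
      conditions : T (vertexOK cj (same ck cj + same cj cl)) × T (edgeOK ck (same ck cj + same ck cl + x) cj (same ck cj + same cj cl))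
                 × T (edgeOK cj (same ck cj + same cj cl) cl (same cj cl + same ck cl + y))
                 × T (edgeOK ck (same ck cj + same ck cl + x) cl (same cj cl + same ck cl + y))
      conditions = Product.map₂ (Product.map₂ split ∘ split) (split (tolerates-segmentWith (archTolerance ck (point cj) cl) x y tol))
      Dj : D (suc p) ≡ same ck cj + same cj cl
      Dj = begin
        D (suc p)                                              ≡⟨ degrees (n<1+n p) (n<1+n (suc p)) ⟩
        innerDegree p (suc (suc p)) g (suc p)                  ≡⟨ innerDegree-under-point g arc ≤-refl clᵢ refl ⟩
        same (g (suc p)) (g p) + same (g (suc p)) (g (suc (suc p))) ≡⟨ cong₂ _+_ (cong₂ same gj gp) (cong₂ same gj gl) ⟩
        same cj ck + same cj cl                                ≡⟨ cong (_+ same cj cl) (same-sym cj ck) ⟩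
        same ck cj + same cj cl                                ∎
        where open ≡-Reasoning
  arch-sound {g} {p} {m} ck t@(segment cp dp cq dq _ _ _ _) cl arc clᵢ gp gl (p+1<m , g₁ , gm , deg₁ , degm , inner) =
    <-trans (n<1+n p) (<-trans p+1<m (n<1+n m)) , gp , gl , degₗ , degᵣ , body
    where
    degₗ : innerDegree p (suc m) g p ≡ same ck cp + same ck cl
    degₗ rewrite innerDegree-arch-left g arc (<⇒≤ p+1<m) | gp | g₁ | gl = refl
    degᵣ : innerDegree p (suc m) g (suc m) ≡ same cq cl + same ck cl
    degᵣ rewrite innerDegree-arch-right g arc (<⇒≤ p+1<m) | gp | gm | gl = cong₂ _+_ (same-sym cl cq) (same-sym cl ck)
    body : ∀ x y D → T (tolerates (arch ck t cl) x y) → D p ≡ same ck cp + same ck cl + x →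
      D (suc m) ≡ same cq cl + same ck cl + y → InteriorDegrees p (suc m) g D →
      VerticesOK p (suc m) g D × EdgesOK p (suc m) g D
    body x y D tol Dp Dl degrees =
      let tolᵢ , ok₁ , okm , first , last , span = conditions
          verticesᵢ , edgesᵢ = inner (same ck cp) (same cq cl) D tolᵢ D₁ Dm (interior-under arc (<⇒≤ p+1<m) clᵢ degrees)
      in vertices-arch g D arc verticesᵢ (vertex-at g₁ D₁ ok₁) (vertex-at gm Dm okm)
       , edges-arch g D arc edgesᵢ (edge-at gp Dp g₁ D₁ first) (edge-at gm Dm gl Dl last) (edge-at gp Dp gl Dl span)
      where
      conditions : T (tolerates t (same ck cp) (same cq cl)) × T (vertexOK cp (dp + same ck cp)) × T (vertexOK cq (dq + same cq cl))
                 × T (edgeOK ck (same ck cp + same ck cl + x) cp (dp + same ck cp))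
                 × T (edgeOK cq (dq + same cq cl) cl (same cq cl + same ck cl + y))
                 × T (edgeOK ck (same ck cp + same ck cl + x) cl (same cq cl + same ck cl + y))
      conditions = Product.map₂ (Product.map₂ (Product.map₂ (Product.map₂ split ∘ split) ∘ split) ∘ split)
                     (split (tolerates-segmentWith (archTolerance ck t cl) x y tol))
      D₁ : D (suc p) ≡ dp + same ck cp
      D₁ = degree-under-first arc clᵢ degrees p+1<m deg₁ gp g₁
      Dm : D m ≡ dq + same cq cl
      Dm = degree-under-last arc clᵢ degrees p+1<m degm gm gl

  sameIf-local : ∀ {P : Set} (P? : Dec P) {a b a′ b′} → (P → a ≡ a′) → (P → b ≡ b′) → sameIf P? a b ≡ sameIf P? a′ b′
  sameIf-local (yes p) a≡a′ b≡b′ = cong₂ same (a≡a′ p) (b≡b′ p)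
  sameIf-local (no _)  _    _    = refl

  Agree : ℕ → ℕ → Colouring → Colouring → Set
  Agree p q g g′ = ∀ {u} → p ≤ u → u ≤ q → g u ≡ g′ u

  innerDegree-local : ∀ {p q g g′ w} → Agree p q g g′ → p ≤ w → w ≤ q → innerDegree p q g w ≡ innerDegree p q g′ w
  innerDegree-local {p} {q} {g} {g′} {w} agree p≤w w≤q = cong₂ _+_ (cong₂ _+_ before after) across
    where
    before : sameIf (p <? w) (g w) (g (pred w)) ≡ sameIf (p <? w) (g′ w) (g′ (pred w))
    before = sameIf-local (p <? w) (λ _ → agree p≤w w≤q) (λ p<w → agree (<⇒≤pred p<w) (≤-trans pred[n]≤n w≤q))
    after : sameIf (w <? q) (g w) (g (suc w)) ≡ sameIf (w <? q) (g′ w) (g′ (suc w))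
    after = sameIf-local (w <? q) (λ _ → agree p≤w w≤q) (λ w<q → agree (≤-trans p≤w (n≤1+n w)) w<q)
    across : chordDegree p q g w (chord w) ≡ chordDegree p q g′ w (chord w)
    across with chord w
    ... | nothing = refl
    ... | just j  = sameIf-local (p ≤? j ×-dec j ≤? q) (λ _ → agree p≤w w≤q) (λ (p≤j , j≤q) → agree p≤j j≤q)

  realises-local : ∀ {p q g g′} t → Agree p q g g′ → Realises p q g′ t → Realises p q g t
  realises-local (point c) agree (refl , gp) = refl , trans (agree ≤-refl ≤-refl) gp
  realises-local {p} {q} {g} {g′} (segment cp dp cq dq _ _ _ _) agree (p<q , gp , gq , degp , degq , inner) =
    p<q , trans (agree ≤-refl (<⇒≤ p<q)) gp , trans (agree (<⇒≤ p<q) ≤-refl) gq ,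
    trans (innerDegree-local agree ≤-refl (<⇒≤ p<q)) degp , trans (innerDegree-local agree (<⇒≤ p<q) ≤-refl) degq ,
    λ x y D tol Dp Dq degrees →
      let vertices , edges = inner x y D tol Dp Dq (λ p<w w<q → trans (degrees p<w w<q) (innerDegree-local agree (<⇒≤ p<w) (<⇒≤ w<q)))
      in (λ {w} p<w w<q → subst (λ c → T (vertexOK c (D w))) (sym (agree (<⇒≤ p<w) (<⇒≤ w<q))) (vertices p<w w<q))
       , (λ {w} {u} p≤w w≤q p≤u u≤q wu → subst₂ (λ a b → T (edgeOK a (D w) b (D u))) (sym (agree p≤w w≤q)) (sym (agree p≤u u≤q))
                                            (edges p≤w w≤q p≤u u≤q wu))

  realises-≤ : ∀ {p q g} t → Realises p q g t → p ≤ q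
  realises-≤ (point _)                  (refl , _)  = ≤-refl
  realises-≤ (segment _ _ _ _ _ _ _ _) (p<q , _)   = <⇒≤ p<q

  Realisable : ℕ → ℕ → Profile → Set
  Realisable p q t = ∃ λ g → Realises p q g t

  join-realisable : ∀ {p q r s t} → ChordClosed p q → ChordClosed (suc q) r →
    Realisable p q s → Realisable (suc q) r t → Realisable p r (join s t)
  join-realisable {q = q} {s = s} {t} clₗ clᵣ (gₗ , Rₗ) (gᵣ , Rᵣ) =
    g , join-sound s t clₗ clᵣ (realises-local s agreeₗ Rₗ) (realises-local t agreeᵣ Rᵣ)
    where
    g : Colouring
    g w = if does (w ≤? q) then gₗ w else gᵣ w
    agreeₗ : Agree _ q g gₗ
    agreeₗ {u} _ u≤q rewrite dec-true (u ≤? q) u≤q = refl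
    agreeᵣ : Agree (suc q) _ g gᵣ
    agreeᵣ {u} q<u _ rewrite dec-false (u ≤? q) (<⇒≱ q<u) = refl

  arch-realisable : ∀ {p m t} ck cl → chord p ≡ just (suc m) → ChordClosed (suc p) m →
    Realisable (suc p) m t → Realisable p (suc m) (arch ck t cl)
  arch-realisable {p} {m} {t} ck cl arc clᵢ (gᵢ , Rᵢ) =
    g , arch-sound ck t cl arc clᵢ gp gl (realises-local t agree Rᵢ)
    where
    g : Colouring
    g w = if does (w ℕ.≟ p) then ck else if does (w ℕ.≟ suc m) then cl else gᵢ w
    gp : g p ≡ ck
    gp rewrite dec-true (p ℕ.≟ p) refl = refl
    gl : g (suc m) ≡ cl
    gl rewrite dec-false (suc m ℕ.≟ p) (λ m+1≡p → <-irrefl (sym m+1≡p) (≤-trans (realises-≤ t Rᵢ) (n≤1+n m)))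
             | dec-true (suc m ℕ.≟ suc m) refl = refl
    agree : Agree (suc p) m g gᵢ
    agree {u} p<u u≤m rewrite dec-false (u ℕ.≟ p) (λ u≡p → <-irrefl (sym u≡p) p<u)
                            | dec-false (u ℕ.≟ suc m) (λ u≡m+1 → <-irrefl u≡m+1 (s≤s u≤m)) = refl

  open Certificate

  FamilyRealisable : ℕ → ℕ → Fin 47 → Set
  FamilyRealisable p q k = All (Realisable p q) (family k)

  join-family : ∀ {p q r} i k → ChordClosed p q → ChordClosed (suc q) r →
    FamilyRealisable p q (item i) → FamilyRealisable (suc q) r k → FamilyRealisable p r (joinTo i k)
  join-family i k clₗ clᵣ Rₗ Rᵣ = All.map realise-one (joins i k)
    where
    realise-one : ∀ {t} → Any (λ a → Any (λ b → join a b ≡ t) (family k)) (family (item i)) → Realisable _ _ t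
    realise-one found with Rs , found′ ← lookupAny Rₗ found with Rt , joined ← lookupAny Rᵣ found′ =
      subst (Realisable _ _) joined (join-realisable clₗ clᵣ Rs Rt)

  arch-family : ∀ {p m} k → chord p ≡ just (suc m) → ChordClosed (suc p) m →
    FamilyRealisable (suc p) m k → FamilyRealisable p (suc m) (item (Fin.suc (archTo k)))
  arch-family k arc clᵢ Rᵢ = All.map realise-one (arches k)
    where
    realise-one : ∀ {t} → Any (λ ck → Any (λ a → Any (λ cl → arch ck a cl ≡ t) colours) (family k)) colours → Realisable _ _ t
    realise-one found with ck , found′ ← Any.satisfied found with Ra , found″ ← lookupAny Rᵢ found′
                       with cl , arched ← Any.satisfied found″ = subst (Realisable _ _) arched (arch-realisable ck cl arc clᵢ Ra)

  data Item : ℕ → ℕ → Set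
  data Decomposition : ℕ → ℕ → Set

  data Item where
    point : ∀ {p} → chord p ≡ nothing → Item p p
    arched : ∀ {p m} → chord p ≡ just (suc m) → Decomposition (suc p) m → Item p (suc m)

  data Decomposition where
    [_] : ∀ {p q} → Item p q → Decomposition p q
    _∷_ : ∀ {p q r} → Item p q → Decomposition (suc q) r → Decomposition p r

  item-≤ : ∀ {p q} → Item p q → p ≤ q
  decomposition-≤ : ∀ {p q} → Decomposition p q → p ≤ q
  item-≤ (point _)  = ≤-refl
  item-≤ (arched _ d) = ≤-trans (n≤1+n _) (≤-trans (decomposition-≤ d) (n≤1+n _))
  decomposition-≤ [ it ]   = item-≤ it
  decomposition-≤ (it ∷ d) = ≤-trans (item-≤ it) (≤-trans (n≤1+n _) (decomposition-≤ d))

  item-closed : ∀ {p q} → Item p q → ChordClosed p q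
  decomposition-closed : ∀ {p q} → Decomposition p q → ChordClosed p q
  item-closed (point none) p≤w w≤p e rewrite ≤-antisym w≤p p≤w with () ← trans (sym none) e
  item-closed {p} (arched arc d) p≤w w≤m+1 e with arch-position p≤w w≤m+1
  ... | left refl  rewrite chord-functional e arc = ≤-trans (n≤1+n p) (≤-trans (decomposition-≤ d) (n≤1+n _)) , ≤-refl
  ... | right refl rewrite chord-functional e (chord-sym arc) = ≤-refl , ≤-trans (n≤1+n p) (≤-trans (decomposition-≤ d) (n≤1+n _))
  ... | under p<w w≤m = let p<j , j≤m = decomposition-closed d p<w w≤m e in ≤-trans (n≤1+n p) p<j , ≤-trans j≤m (n≤1+n _)
  decomposition-closed [ it ] = item-closed it
  decomposition-closed {p} (_∷_ {q = q} it d) {w} p≤w w≤r e with w ≤? q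
  ... | yes w≤q = let p≤j , j≤q = item-closed it p≤w w≤q e in p≤j , ≤-trans j≤q (≤-trans (n≤1+n q) (decomposition-≤ d))
  ... | no  w≰q = let q<j , j≤r = decomposition-closed d (≰⇒> w≰q) w≤r e in ≤-trans (item-≤ it) (≤-trans (n≤1+n q) q<j) , j≤r

  module _ {p q : ℕ} (cl : ChordClosed p q) where

    closed-tail : chord p ≡ nothing → ChordClosed (suc p) q
    closed-tail none {w} {j} p<w w≤q e with cl (<⇒≤ p<w) w≤q e
    ... | p≤j , j≤q with p ℕ.≟ j
    ...   | yes refl with () ← trans (sym none) (chord-sym e)
    ...   | no  p≢j  = ≤∧≢⇒< p≤j p≢j , j≤q

    closed-under : ∀ {m} → chord p ≡ just (suc m) → suc m ≤ q → ChordClosed (suc p) m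
    closed-under {m} arc m<q {w} {j} p<w w≤m e with cl (<⇒≤ p<w) (≤-trans w≤m (<⇒≤ m<q)) e
    ... | p≤j , _ = ≤∧≢⇒< p≤j p≢j , j≤m
      where
      p≢j : p ≢ j
      p≢j refl = <-irrefl (sym (chord-functional arc (chord-sym e))) (s≤s w≤m)
      j≤m : j ≤ m
      j≤m with <-cmp j (suc m)
      ... | tri< j<m+1 _ _ = ≤-pred j<m+1
      ... | tri≈ _ refl _  = ⊥-elim (<-irrefl (chord-functional (chord-sym arc) (chord-sym e)) p<w)
      ... | tri> _ _ m+1<j = ⊥-elim (noncrossing arc e p<w (s≤s w≤m) m+1<j)

    closed-after : ∀ {m} → chord p ≡ just (suc m) → suc p ≤ m → ChordClosed (suc (suc m)) q
    closed-after {m} arc p<m {w} {j} m+1<w w≤q e with cl (≤-trans (≤-trans (n≤1+n p) (≤-trans p<m (n≤1+n m))) (<⇒≤ m+1<w)) w≤q e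
    ... | p≤j , j≤q = m+1<j , j≤q
      where
      m+1<j : suc m < j
      m+1<j with <-cmp j (suc m)
      ... | tri> _ _ m+1<j = m+1<j
      ... | tri≈ _ refl _  =
        ⊥-elim (<-irrefl (chord-functional (chord-sym arc) (chord-sym e)) (<-trans (s≤s (≤-trans (n≤1+n p) p<m)) m+1<w))
      ... | tri< j<m+1 _ _ with <-cmp p j
      ...   | tri< p<j _ _ = ⊥-elim (noncrossing arc (chord-sym e) p<j j<m+1 m+1<w)
      ...   | tri≈ _ refl _ = ⊥-elim (<-irrefl (chord-functional arc (chord-sym e)) m+1<w)
      ...   | tri> _ _ j<p = ⊥-elim (<⇒≱ j<p p≤j)

  decompose′ : ∀ fuel {p q} → q ≤ p + fuel → ChordClosed p q → p ≤ q → Decomposition p q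
  decompose′ zero {p} q≤p cl p≤q with ≤-antisym (subst (_ ≤_) (+-identityʳ p) q≤p) p≤q
  ... | refl with chord p in e
  ...   | nothing = [ point e ]
  ...   | just _  = ⊥-elim (point-no-chord cl e)
  decompose′ (suc f) {p} {q} q≤p+f+1 cl p≤q with chord p in e
  ... | nothing with p ℕ.≟ q
  ...   | yes refl = [ point e ]
  ...   | no  p≢q  = point e ∷ decompose′ f (subst (q ≤_) (+-suc p f) q≤p+f+1) (closed-tail cl e) (≤∧≢⇒< p≤q p≢q)
  decompose′ (suc f) {p} {q} q≤p+f+1 cl p≤q | just j with cl ≤-refl p≤q e | chord-long e
  ... | p≤j , _   | inj₂ j+1<p = ⊥-elim (<⇒≱ j+1<p (≤-trans p≤j (n≤1+n j)))
  ... | _ , m+1≤q | inj₁ (s≤s {n = m} p<m) = attach (suc m ℕ.≟ q)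
    where
    inner : Decomposition (suc p) m
    inner = decompose′ f (≤-trans (n≤1+n m) (≤-trans m+1≤q (≤-trans q≤p+f+1 (≤-reflexive (+-suc p f)))))
                       (closed-under cl e m+1≤q) p<m
    after : q ≤ suc (suc m) + f
    after = ≤-trans q≤p+f+1 (≤-trans (≤-reflexive (+-suc p f))
                                     (s≤s (+-monoˡ-≤ f (≤-trans (n≤1+n p) (≤-trans p<m (n≤1+n m))))))
    attach : Dec (suc m ≡ q) → Decomposition p q
    attach (yes m+1≡q) = subst (Decomposition p) m+1≡q [ arched e inner ]
    attach (no  m+1≢q) = arched e inner ∷ decompose′ f after (closed-after cl e p<m) (≤∧≢⇒< m+1≤q m+1≢q)

  decompose : ∀ {p q} → ChordClosed p q → p ≤ q → Decomposition p q
  decompose {p} {q} = decompose′ q (m≤n+m q p)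

  points-realisable : ∀ {p} → FamilyRealisable p p (item Fin.zero)
  points-realisable = ((λ _ → blue) , refl , refl) ∷ ((λ _ → red) , refl , refl) ∷ []

  realise-item : ∀ {p q} → Item p q → ∃ λ i → FamilyRealisable p q (item i)
  realise : ∀ {p q} → Decomposition p q → ∃ λ k → FamilyRealisable p q k
  realise-item (point _)      = Fin.zero , points-realisable
  realise-item (arched arc d) = let k , R = realise d in Fin.suc (archTo k) , arch-family k arc (decomposition-closed d) R
  realise [ it ]   = let i , R = realise-item it in item i , R
  realise (it ∷ d) = let i , Rᵢ = realise-item it ; k , R = realise d in
    joinTo i k , join-family i k (item-closed it) (decomposition-closed d) Rᵢ R

  not-point-family : ∀ {p q k} → p < q → FamilyRealisable p q k → k ≢ Fin.zero
  not-point-family {k = Fin.zero}  p<q ((_ , p≡q , _) ∷ _) _  = <-irrefl p≡q p<q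
  not-point-family {k = Fin.suc _} _   _                    ()

  closing-family : ∃ λ k → ClosesCycle (family k) × FamilyRealisable 0 last k
  closing-family with decompose {0} {last} (λ _ _ e → z≤n , chord-≤ e) z≤n
  ... | [ point _ ]      = ⊥-elim (<⇒≱ 2≤last z≤n)
  ... | [ arched arc _ ] = ⊥-elim (<-irrefl refl (chord-0 arc))
  ... | point e ∷ d =
    joinTo Fin.zero (proj₁ (realise d)) ,
    closes-point (proj₁ (realise d)) (not-point-family 2≤last (proj₂ (realise d))) ,
    proj₂ (realise (point e ∷ d))
  ... | arched arc d′ ∷ d =
    joinTo (Fin.suc a) (proj₁ (realise d)) , closes-arch a (proj₁ (realise d)) , proj₂ (realise (arched arc d′ ∷ d))
    where a = archTo (proj₁ (realise d′))

  Neighbour : ℕ → ℕ → Set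
  Neighbour i j = j ≡ prev i ⊎ j ≡ next i ⊎ chord i ≡ just j

  chordSame : Colouring → ℕ → Maybe ℕ → ℕ
  chordSame g i nothing  = 0
  chordSame g i (just j) = same (g i) (g j)

  cycleDegree : Colouring → ℕ → ℕ
  cycleDegree g i = same (g i) (g (prev i)) + same (g i) (g (next i)) + chordSame g i (chord i)

  record LocallyCrumby (g : Colouring) : Set where
    field
      vertices : ∀ {i} → i ≤ last → T (vertexOK (g i) (cycleDegree g i))
      edges    : ∀ {i j} → i ≤ last → Neighbour i j → T (edgeOK (g i) (cycleDegree g i) (g j) (cycleDegree g j))

  chordSame-whole : ∀ g w → chordDegree 0 last g w (chord w) ≡ chordSame g w (chord w)
  chordSame-whole g w with chord w in e
  ... | nothing = refl
  ... | just j  = sameIf-yes (0 ≤? j ×-dec j ≤? last) (z≤n , chord-≤ e)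

  cycleDegree-interior : ∀ g {w} → 0 < w → w < last → cycleDegree g w ≡ innerDegree 0 last g w
  cycleDegree-interior g {suc w} 0<w w<last
    rewrite next-< w<last | sameIf-yes (0 <? suc w) {g (suc w)} {g w} 0<w | sameIf-yes (suc w <? last) {g (suc w)} {g (suc (suc w))} w<last
          | chordSame-whole g (suc w) = refl

  cycleDegree-first : ∀ g → cycleDegree g 0 ≡ innerDegree 0 last g 0 + same (g 0) (g last)
  cycleDegree-first g
    rewrite next-< {0} (<-trans z<s 2≤last) | sameIf-yes (0 <? last) {g 0} {g 1} (<-trans z<s 2≤last) | chordSame-whole g 0 =
    move-first (same (g 0) (g last)) (same (g 0) (g 1)) (chordSame g 0 (chord 0))

  cycleDegree-last : ∀ g → cycleDegree g last ≡ innerDegree 0 last g last + same (g last) (g 0)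
  cycleDegree-last g
    rewrite next-last | prev-pred (<-trans z<s 2≤last) | sameIf-yes (0 <? last) {g last} {g (pred last)} (<-trans z<s 2≤last)
          | sameIf-no (last <? last) {g last} {g (suc last)} (<-irrefl refl) | chordSame-whole g last =
    move-last (same (g last) (g (pred last))) (same (g last) (g 0)) (chordSame g last (chord last))

  interval⇒cycle : ∀ {g} → let D = cycleDegree g in
    T (vertexOK (g 0) (D 0)) → T (vertexOK (g last) (D last)) → T (edgeOK (g 0) (D 0) (g last) (D last)) →
    VerticesOK 0 last g D → EdgesOK 0 last g D → LocallyCrumby g
  interval⇒cycle {g} ok-0 ok-last closing inside-vertices inside-edges = record { vertices = vertices ; edges = edges }
    where
    D = cycleDegree g
    vertices : ∀ {i} → i ≤ last → T (vertexOK (g i) (D i))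
    vertices {zero}  _      = ok-0
    vertices {suc i} i≤last with suc i ℕ.≟ last
    ... | yes refl   = ok-last
    ... | no  i≢last = inside-vertices z<s (≤∧≢⇒< i≤last i≢last)
    edges : ∀ {i j} → i ≤ last → Neighbour i j → T (edgeOK (g i) (D i) (g j) (D j))
    edges {zero}  _      (inj₁ refl) = closing
    edges {suc i} i≤last (inj₁ refl) = inside-edges z≤n i≤last z≤n (≤-trans (n≤1+n i) i≤last) (inj₂ (inj₁ refl))
    edges {i}     i≤last (inj₂ (inj₁ refl)) with i ℕ.≟ last
    ... | yes refl   = subst (λ j → T (edgeOK (g last) (D last) (g j) (D j))) (sym next-last)
                         (subst T (edgeOK-sym (g 0) (D 0) (g last) (D last)) closing)
    ... | no  i≢last = subst (λ j → T (edgeOK (g i) (D i) (g j) (D j))) (sym (next-< i<last))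
                         (inside-edges z≤n i≤last z≤n i<last (inj₁ refl))
      where
      i<last = ≤∧≢⇒< i≤last i≢last
    edges         i≤last (inj₂ (inj₂ e)) = inside-edges z≤n i≤last z≤n (chord-≤ e) (inj₂ (inj₂ e))

  close-cycle : ∀ {g c} t → Realises 0 last g t → T (closesCycle t c) → g 0 ≡ c × LocallyCrumby g
  close-cycle (point _) _ ()
  close-cycle {g} {c} t@(segment cp dp cq dq _ _ _ _) (_ , g0 , glast , deg0 , deglast , inner) closes =
    let c-is-cp , tol , ok0 , oklast , closing = conditions
        inside-vertices , inside-edges = inner δ δ (cycleDegree g) tol D0 Dlast (cycleDegree-interior g)
    in trans g0 (sym (isColour-sound c-is-cp)) ,
       interval⇒cycle (vertex-at g0 D0 ok0) (vertex-at glast Dlast oklast) (edge-at g0 D0 glast Dlast closing)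
                      inside-vertices inside-edges
    where
    δ = same cp cq
    conditions : T (isColour c cp) × T (tolerates t δ δ) × T (vertexOK cp (dp + δ)) × T (vertexOK cq (dq + δ))
               × T (edgeOK cp (dp + δ) cq (dq + δ))
    conditions = Product.map₂ (Product.map₂ (Product.map₂ split ∘ split) ∘ split) (split closes)
    D0 : cycleDegree g 0 ≡ dp + δ
    D0 = trans (cycleDegree-first g) (cong₂ _+_ deg0 (cong₂ same g0 glast))
    Dlast : cycleDegree g last ≡ dq + δ
    Dlast = trans (cycleDegree-last g) (trans (cong₂ _+_ deglast (cong₂ same glast g0)) (cong (dq +_) (same-sym cq cp)))

  locally-crumby-colouring : ∀ c → ∃ λ g → g 0 ≡ c × LocallyCrumby g
  locally-crumby-colouring c with k , closes , R ← closing-family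
    with (g , realises) , closes-c ← lookupAny R (All.lookup closes (∈-colours c)) = g , close-cycle _ realises closes-c

  same-≢ : ∀ {a b} → b ≢ a → same a b ≡ 0
  same-≢ {red}  {red}  b≢a = ⊥-elim (b≢a refl)
  same-≢ {blue} {blue} b≢a = ⊥-elim (b≢a refl)
  same-≢ {red}  {blue} _   = refl
  same-≢ {blue} {red}  _   = refl

  same-≡ : ∀ {a b} → b ≡ a → same a b ≡ 1
  same-≡ {red}  refl = refl
  same-≡ {blue} refl = refl

  same-coloured-neighbour : ∀ g i → 1 ≤ cycleDegree g i → ∃ λ j → Neighbour i j × g j ≡ g i
  same-coloured-neighbour g i 1≤deg with g (prev i) ≟ᶜ g i | g (next i) ≟ᶜ g i
  ... | yes prev-same | _            = prev i , inj₁ refl , prev-same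
  ... | no  _         | yes next-same = next i , inj₂ (inj₁ refl) , next-same
  ... | no  prev-differs | no next-differs with chord i
  ...   | nothing =
    ⊥-elim (<⇒≱ 1≤deg (≤-reflexive (cong₂ _+_ (cong₂ _+_ (same-≢ prev-differs) (same-≢ next-differs)) refl)))
  ...   | just j with g j ≟ᶜ g i
  ...     | yes j-same    = j , inj₂ (inj₂ refl) , j-same
  ...     | no  j-differs =
    ⊥-elim (<⇒≱ 1≤deg (≤-reflexive (cong₂ _+_ (cong₂ _+_ (same-≢ prev-differs) (same-≢ next-differs)) (same-≢ j-differs))))

  private
    2≤ab : ∀ {a b} c → a ≡ 1 → b ≡ 1 → 2 ≤ a + b + c
    2≤ab _ refl refl = s≤s (s≤s z≤n)

    2≤ac : ∀ {a c} b → a ≡ 1 → c ≡ 1 → 2 ≤ a + b + c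
    2≤ac b refl refl = s≤s (m≤n+m 1 b)

    2≤bc : ∀ {b c} a → b ≡ 1 → c ≡ 1 → 2 ≤ a + b + c
    2≤bc a refl refl = ≤-trans (m≤n+m 2 a) (≤-reflexive (sym (+-assoc a 1 1)))

  two-same-coloured-neighbours : ∀ g {i j k} → Neighbour i j → Neighbour i k → j ≢ k → g j ≡ g i → g k ≡ g i →
    2 ≤ cycleDegree g i
  two-same-coloured-neighbours g (inj₁ refl)        (inj₁ refl)        j≢k _  _  = ⊥-elim (j≢k refl)
  two-same-coloured-neighbours g (inj₂ (inj₁ refl)) (inj₂ (inj₁ refl)) j≢k _  _  = ⊥-elim (j≢k refl)
  two-same-coloured-neighbours g (inj₂ (inj₂ e))    (inj₂ (inj₂ e′))   j≢k _  _  = ⊥-elim (j≢k (chord-functional e e′))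
  two-same-coloured-neighbours g (inj₁ refl)        (inj₂ (inj₁ refl)) _   gj gk = 2≤ab _ (same-≡ gj) (same-≡ gk)
  two-same-coloured-neighbours g (inj₂ (inj₁ refl)) (inj₁ refl)        _   gj gk = 2≤ab _ (same-≡ gk) (same-≡ gj)
  two-same-coloured-neighbours g (inj₁ refl)        (inj₂ (inj₂ e))    _   gj gk rewrite e = 2≤ac _ (same-≡ gj) (same-≡ gk)
  two-same-coloured-neighbours g (inj₂ (inj₂ e))    (inj₁ refl)        _   gj gk rewrite e = 2≤ac _ (same-≡ gk) (same-≡ gj)
  two-same-coloured-neighbours g (inj₂ (inj₁ refl)) (inj₂ (inj₂ e))    _   gj gk rewrite e = 2≤bc _ (same-≡ gj) (same-≡ gk)
  two-same-coloured-neighbours g (inj₂ (inj₂ e))    (inj₂ (inj₁ refl)) _   gj gk rewrite e = 2≤bc _ (same-≡ gk) (same-≡ gj)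

-- The cycle and chords of G

module _ {m} (G : Graph (suc m)) {v} (N : CyclicNumbering G v) (2≤m : 2 ≤ m) (conn : Connected G)
         (noCut : ∀ x → ConnectedOn G (λ u → u ≢ x)) (subcubic : Subcubic G) where
  open CyclicNumbering N
  open Cycle m

  at : ℕ → Fin (suc m)
  at = vertexAt

  rank-at : ∀ {i} → i ≤ m → rank (at i) ≡ i
  rank-at i≤m = rank-vertexAt (s≤s i≤m)

  at-injective : ∀ {i j} → i ≤ m → j ≤ m → at i ≡ at j → i ≡ j
  at-injective i≤m j≤m e = trans (sym (rank-at i≤m)) (trans (cong rank e) (rank-at j≤m))

  rank≤m : ∀ u → rank u ≤ m
  rank≤m u = ≤-pred (bounded u)

  adjacent-next : ∀ {i} → i ≤ m → Adj G (at i) (at (next i))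
  adjacent-next {i} i≤m with i ℕ.≟ m
  ... | yes refl = subst (Adj G (at m) ∘ at) (sym next-last)
                     (last-first-adjacent placement conn noCut (≤-trans (s≤s z≤n) 2≤m) (rank-at ≤-refl) (rank-at z≤n))
  ... | no  i≢m  = subst (Adj G (at i) ∘ at) (sym (next-< i<m))
                     (successor-adjacent G placement conn noCut (trans (cong suc (rank-at i≤m)) (sym (rank-at i<m))))
    where
    i<m : i < m
    i<m = ≤∧≢⇒< i≤m i≢m

  adjacent-prev : ∀ {i} → i ≤ m → Adj G (at i) (at (prev i))
  adjacent-prev {i} i≤m = adj-sym G (subst (Adj G (at (prev i)) ∘ at) (next-prev i≤m) (adjacent-next (prev-≤ i≤m)))

  IsChord : ℕ → ℕ → Set
  IsChord i j = i ≤ m × j ≤ m × Adj G (at i) (at j) × j ≢ prev i × j ≢ next i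

  isChord? : ∀ i j → Dec (IsChord i j)
  isChord? i j = i ≤? m ×-dec j ≤? m ×-dec adj G (at i) (at j) Bool.≟ true ×-dec ¬? (j ℕ.≟ prev i) ×-dec ¬? (j ℕ.≟ next i)

  -- with its two cycle neighbours, a vertex on two chords would have degree 4
  chord-unique : ∀ {i j k} → IsChord i j → IsChord i k → j ≡ k
  chord-unique {i} {j} {k} (i≤m , j≤m , ij , j≢prev , j≢next) (_ , k≤m , ik , k≢prev , k≢next) with j ℕ.≟ k
  ... | yes j≡k = j≡k
  ... | no  j≢k = ⊥-elim (<⇒≱ (s≤s (subcubic (at i))) (distinct-≤-countB (adj G (at i)) _ distinct adjacent))
    where
    apart : ∀ {a b} → a ≤ m → b ≤ m → a ≢ b → at a ≢ at b
    apart a≤m b≤m a≢b = a≢b ∘ at-injective a≤m b≤m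
    distinct : AllPairs _≢_ (at (prev i) ∷ at (next i) ∷ at j ∷ at k ∷ [])
    distinct = (apart (prev-≤ i≤m) (next-≤ i≤m) (prev≢next 2≤m i≤m)
               ∷ apart (prev-≤ i≤m) j≤m (j≢prev ∘ sym) ∷ apart (prev-≤ i≤m) k≤m (k≢prev ∘ sym) ∷ [])
             ∷ (apart (next-≤ i≤m) j≤m (j≢next ∘ sym) ∷ apart (next-≤ i≤m) k≤m (k≢next ∘ sym) ∷ [])
             ∷ (apart j≤m k≤m j≢k ∷ []) ∷ [] ∷ []
    adjacent : All (λ u → adj G (at i) u ≡ true) (at (prev i) ∷ at (next i) ∷ at j ∷ at k ∷ [])
    adjacent = adjacent-prev i≤m ∷ adjacent-next i≤m ∷ ij ∷ ik ∷ []

  ChordSearch : ℕ → Set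
  ChordSearch i = Dec (∃ λ (j : Fin (suc m)) → IsChord i (toℕ j))

  found : ∀ {i} → ChordSearch i → Maybe ℕ
  found (yes (j , _)) = just (toℕ j)
  found (no  _)       = nothing

  chord : ℕ → Maybe ℕ
  chord i = found (any? (λ j → isChord? i (toℕ j)))

  chord-isChord : ∀ {i j} → chord i ≡ just j → IsChord i j
  chord-isChord {i} = sound (any? (λ j → isChord? i (toℕ j)))
    where
    sound : ∀ {j} (search : ChordSearch i) → found search ≡ just j → IsChord i j
    sound (yes (_ , c)) refl = c

  isChord-chord : ∀ {i j} → IsChord i j → chord i ≡ just j
  isChord-chord {i} {j} c = complete (any? (λ j → isChord? i (toℕ j)))
    where
    complete : (search : ChordSearch i) → found search ≡ just j
    complete (yes (_ , c′)) = cong just (chord-unique c′ c)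
    complete (no  none)     = ⊥-elim (none (fromℕ< (s≤s (proj₁ (proj₂ c))) , subst (IsChord i) (sym (toℕ-fromℕ< _)) c))

  chordedCycle : ChordedCycle
  chordedCycle = record
    { last        = m
    ; 2≤last      = 2≤m
    ; chord       = chord
    ; chord-sym   = λ e → let i≤m , j≤m , ij , j≢prev , j≢next = chord-isChord e in
                      isChord-chord (j≤m , i≤m , adj-sym G ij ,
                                     (λ i≡prev → j≢next (trans (sym (next-prev j≤m)) (cong next (sym i≡prev)))) ,
                                     (λ i≡next → j≢prev (trans (sym (prev-next j≤m)) (cong prev (sym i≡next)))))
    ; chord-≤     = proj₁ ∘ proj₂ ∘ chord-isChord
    ; chord-long  = λ e → let i≤m , j≤m , ij , j≢prev , j≢next = chord-isChord e in
                      far-apart i≤m j≤m (λ { refl → adj-irrefl G ij }) j≢prev j≢next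
    ; chord-0     = λ e → let _ , j≤m , _ , j≢m , _ = chord-isChord e in ≤∧≢⇒< j≤m j≢m
    ; noncrossing = λ {a} {b} {c} {d} ab cd a<c c<b b<d →
                      let a≤m , b≤m , a~b , _ = chord-isChord ab ; c≤m , d≤m , c~d , _ = chord-isChord cd in
                      nonCrossing (at a) (at b) (at c) (at d) a~b c~d
                        (subst₂ _<_ (sym (rank-at a≤m)) (sym (rank-at c≤m)) a<c)
                        (subst₂ _<_ (sym (rank-at c≤m)) (sym (rank-at b≤m)) c<b)
                        (subst₂ _<_ (sym (rank-at b≤m)) (sym (rank-at d≤m)) b<d)
    }

  open CycleColouring chordedCycle using (Neighbour)

  neighbour-≤ : ∀ {i j} → i ≤ m → Neighbour i j → j ≤ m
  neighbour-≤ i≤m (inj₁ refl)        = prev-≤ i≤m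
  neighbour-≤ i≤m (inj₂ (inj₁ refl)) = next-≤ i≤m
  neighbour-≤ i≤m (inj₂ (inj₂ e))    = proj₁ (proj₂ (chord-isChord e))

  adjacent-neighbour : ∀ {i j} → i ≤ m → Neighbour i j → Adj G (at i) (at j)
  adjacent-neighbour i≤m (inj₁ refl)        = adjacent-prev i≤m
  adjacent-neighbour i≤m (inj₂ (inj₁ refl)) = adjacent-next i≤m
  adjacent-neighbour i≤m (inj₂ (inj₂ e))    = proj₁ (proj₂ (proj₂ (chord-isChord e)))

  neighbour-adjacent : ∀ {u w} → Adj G u w → Neighbour (rank u) (rank w)
  neighbour-adjacent {u} {w} uw with rank w ℕ.≟ prev (rank u) | rank w ℕ.≟ next (rank u)
  ... | yes w≡prev | _          = inj₁ w≡prev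
  ... | no  _      | yes w≡next = inj₂ (inj₁ w≡next)
  ... | no  w≢prev | no  w≢next = inj₂ (inj₂ (isChord-chord (rank≤m u , rank≤m w , at-uw , w≢prev , w≢next)))
    where
    at-uw : Adj G (at (rank u)) (at (rank w))
    at-uw = subst₂ (Adj G) (sym (vertexAt-rank u)) (sym (vertexAt-rank w)) uw

  module _ {g : ℕ → Colour} (locally : CycleColouring.LocallyCrumby chordedCycle g) where
    open CycleColouring chordedCycle using (cycleDegree; same-coloured-neighbour; two-same-coloured-neighbours)
    open CycleColouring.LocallyCrumby locally

    private
      f : Fin (suc m) → Colour
      f = g ∘ rank

      crowded : ∀ {u a b} → Adj G u a → Adj G u b → a ≢ b → f a ≡ f u → f b ≡ f u → 2 ≤ cycleDegree g (rank u)
      crowded ua ub a≢b = two-same-coloured-neighbours g (neighbour-adjacent ua) (neighbour-adjacent ub) (a≢b ∘ injective)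

      degree-≤1 : ∀ {u} → f u ≡ blue → cycleDegree g (rank u) ≤ 1
      degree-≤1 {u} fu≡blue = ≤ᵇ⇒≤ _ 1 (subst (λ c → T (vertexOK c (cycleDegree g (rank u)))) fu≡blue (vertices (rank≤m u)))

      degree-≥1 : ∀ {u} → f u ≡ red → 1 ≤ cycleDegree g (rank u)
      degree-≥1 {u} fu≡red = ≤ᵇ⇒≤ 1 _ (subst (λ c → T (vertexOK c (cycleDegree g (rank u)))) fu≡red (vertices (rank≤m u)))

      split-if : ∀ {a b} → (if a then b else false) ≡ true → a ≡ true × T b
      split-if {true} {true} refl = refl , tt

    crumby : Crumby G (g ∘ rank)
    crumby = blue-sparse , red-paired , no-red-P₄
      where
      blue-sparse : ∀ u → f u ≡ blue → colDegree G f blue u ≤ 1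
      blue-sparse u fu≡blue = countB-≤1 _ λ w₁ w₂ p₁ p₂ → case w₁ Fin.≟ w₂ of λ
        { (yes w₁≡w₂) → w₁≡w₂
        ; (no  w₁≢w₂) → let uw₁ , b₁ = split-if p₁ ; uw₂ , b₂ = split-if p₂ in
            ⊥-elim (<⇒≱ (crowded uw₁ uw₂ w₁≢w₂ (trans (sym (isColour-sound b₁)) (sym fu≡blue))
                                             (trans (sym (isColour-sound b₂)) (sym fu≡blue))) (degree-≤1 fu≡blue)) }

      red-paired : ∀ u → f u ≡ red → ∃ λ w → Adj G u w × f w ≡ red
      red-paired u fu≡red with j , u~j , gj≡gu ← same-coloured-neighbour g (rank u) (degree-≥1 fu≡red) =
        at j , subst (λ x → Adj G x (at j)) (vertexAt-rank u) (adjacent-neighbour (rank≤m u) u~j) ,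
        trans (cong g (rank-at (neighbour-≤ (rank≤m u) u~j))) (trans gj≡gu fu≡red)

      no-red-P₄ : ∀ a b c d → a ≢ b → a ≢ c → a ≢ d → b ≢ c → b ≢ d → c ≢ d →
        f a ≡ red → f b ≡ red → f c ≡ red → f d ≡ red → Adj G a b → Adj G b c → Adj G c d → ⊥
      no-red-P₄ a b c d _ a≢c _ _ b≢d _ fa fb fc fd ab bc cd with edges (rank≤m b) (neighbour-adjacent bc)
      ... | edge-ok
        with Equivalence.to T-∨ (subst₂ (λ x y → T (edgeOK x (cycleDegree g (rank b)) y (cycleDegree g (rank c)))) fb fc edge-ok)
      ...   | inj₁ b≤1 = <⇒≱ (crowded (adj-sym G ab) bc a≢c (trans fa (sym fb)) (trans fc (sym fb))) (≤ᵇ⇒≤ _ 1 b≤1)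
      ...   | inj₂ c≤1 = <⇒≱ (crowded (adj-sym G bc) cd b≢d (trans fb (sym fc)) (trans fd (sym fc))) (≤ᵇ⇒≤ _ 1 c≤1)

theorem3p1 : ∀ {n} (G : Graph n) → TwoConnected G → Subcubic G → Outerplanar G →
    (v : Fin n) (c : Colour) → ∃ λ (f : Fin n → Colour) → Crumby G f × f v ≡ c
theorem3p1 {suc m} G (3≤n , conn , noCut) subcubic outerplanar v c =
  let N = outerplanar-numbering outerplanar v
      C = chordedCycle G N (≤-pred 3≤n) conn noCut subcubic
      g , g0≡c , locally = CycleColouring.locally-crumby-colouring C c
  in g ∘ CyclicNumbering.rank N , crumby G N (≤-pred 3≤n) conn noCut subcubic locally ,
     trans (cong g (CyclicNumbering.rank-v N)) g0≡c
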